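{- Let $G$ be a connected finite simple graph with toughness $\tau(G)=t\le 1$, and let $S$ be a tough-set of $G$. Then: (i) For every nonempty $S'\subsetneq S$, the vertices of $S'$ are adjacent in $G$ to at least $|S'|/t+1$ components of $G-S$. (ii) For every nonempty $S'\subseteq S$, the vertices of $S'$ are adjacent in $G$ to at least $|S'|/t$ components of $G-S$. (iii) Every vertex of $S$ is adjacent to at least two components of $G-S$. (iv) If $S$ is a maximal tough-set of $G$, $k$ is a positive integer with $t\ge \frac1k$, and $R$ is a component of $G-S$, then $R$ is $\frac1k$-tough. (v) If $G$ has no induced subgraph isomorphic to the path $P_4$ on four vertices, $R$ is a component of $G-S$, and $G'$ is the (simple) graph obtained from $G$ by contracting $R$ into a single vertex, then $G'$ is $t$-tough.
   Context: For $S\subseteq V(G)$, $G-S$ is the subgraph induced on $V(G)-S$ and $c(H)$ is the number of components of $H$. For real $t\ge0$, $G$ is $t$-tough if $|S|\ge t\cdot c(G-S)$ for every $S$ with $c(G-S)\ge2$; the toughness $\tau(G)$ is the largest such $t$ ($\infty$ if $G$ is complete). A cutset is a set $S$ with $G-S$ disconnected. A tough-set of $G$ is a cutset $S$ with $|S|/c(G-S)=\tau(G)$; it is maximal if it is not properly contained in another tough-set. -}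

module Defs where

open import Data.Nat as ℕ using (ℕ; zero; suc)
open import Data.Fin using (Fin)
open import Data.Fin.Subset using (Subset; _∈_; _∉_; _⊆_; ∁; _─_; ∣_∣; ⊤; Nonempty)
open import Data.Integer using (+_)
open import Data.Rational as ℚ using (ℚ; 0ℚ; _/_)
open import Data.Product using (Σ; ∃; ∃-syntax; _×_; _,_)
open import Data.Sum using (_⊎_)
open import Function.Bundles using (_⇔_)
open import Function.Definitions using (Injective)
open import Relation.Nullary using (¬_; Dec)
open import Relation.Binary.PropositionalEquality using (_≡_; _≢_)

ℕ→ℚ : ℕ → ℚ
ℕ→ℚ m = (+ m) / 1

record Graph (n : ℕ) : Set₁ where
  field
    Adj    : Fin n → Fin n → Set
    sym    : ∀ {u v} → Adj u v → Adj v u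
    irrefl : ∀ {u} → ¬ Adj u u
    dec    : ∀ u v → Dec (Adj u v)
open Graph public

module _ {n : ℕ} (A : Fin n → Fin n → Set) where

  data Reach (W : Subset n) : Fin n → Fin n → Set where
    here : ∀ {u} → u ∈ W → Reach W u u
    step : ∀ {u v w} → u ∈ W → A u v → Reach W v w → Reach W u w

  -- The induced subgraph on W has exactly k components: the connectivity
  -- classes of W are in bijection with Fin k (via the labelling f).
  NumComponents : Subset n → ℕ → Set
  NumComponents W k =
    Σ (Fin n → Fin k) λ f →
      (∀ i → ∃[ v ] (v ∈ W × f v ≡ i)) ×
      (∀ u v → u ∈ W → v ∈ W → (f u ≡ f v ⇔ Reach W u v))

  IsComponent : Subset n → Subset n → Set
  IsComponent W R =
    Nonempty R × R ⊆ W ×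
    (∀ u v → u ∈ R → v ∈ R → Reach W u v) ×
    (∀ u v → u ∈ R → Reach W u v → v ∈ R)

  ToughOn : Subset n → ℚ → Set
  ToughOn W t =
    0ℚ ℚ.≤ t ×
    (∀ T c → T ⊆ W → NumComponents (W ─ T) c → 2 ℕ.≤ c → t ℚ.* ℕ→ℚ c ℚ.≤ ℕ→ℚ ∣ T ∣)

  AdjSets : Subset n → Subset n → Set
  AdjSets X R = ∃[ u ] ∃[ v ] (u ∈ X × v ∈ R × A u v)

module _ {n : ℕ} (G : Graph n) where

  Connected : Set
  Connected = ∀ u v → Reach (Adj G) ⊤ u v

  Tough : ℚ → Set
  Tough t = ToughOn (Adj G) ⊤ t

  Toughness≡ : ℚ → Set
  Toughness≡ t = Tough t × (∀ t′ → Tough t′ → t′ ℚ.≤ t)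

  ToughSet : Subset n → Set
  ToughSet S = Σ ℚ λ t → Toughness≡ t ×
    ∃[ c ] (NumComponents (Adj G) (∁ S) c × 2 ℕ.≤ c × ℕ→ℚ ∣ S ∣ ≡ t ℚ.* ℕ→ℚ c)

  MaximalToughSet : Subset n → Set
  MaximalToughSet S = ToughSet S × (∀ S′ → ToughSet S′ → S ⊆ S′ → S′ ⊆ S)

  AdjToAtLeast : Subset n → Subset n → ℕ → Set
  AdjToAtLeast S X m =
    Σ (Fin m → Subset n) λ Rs → Injective _≡_ _≡_ Rs ×
      (∀ j → IsComponent (Adj G) (∁ S) (Rs j) × AdjSets (Adj G) X (Rs j))

  HasInducedP4 : Set
  HasInducedP4 = ∃[ a ] ∃[ b ] ∃[ c ] ∃[ d ]
    (a ≢ b × a ≢ c × a ≢ d × b ≢ c × b ≢ d × c ≢ d ×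
     Adj G a b × Adj G b c × Adj G c d ×
     ¬ Adj G a c × ¬ Adj G b d × ¬ Adj G a d)

  -- Contraction of R ⊆ V(G) into the single vertex r ∈ R: the resulting simple
  -- graph G′ is the induced subgraph of ContractAdj R r on (V(G) ─ R) ∪ {r};
  -- r is adjacent to v ∉ R iff some vertex of R is adjacent to v in G.
  ContractAdj : Subset n → Fin n → Fin n → Fin n → Set
  ContractAdj R r u v =
    (u ∉ R × v ∉ R × Adj G u v) ⊎
    (u ≡ r × v ∉ R × ∃[ w ] (w ∈ R × Adj G w v)) ⊎
    (v ≡ r × u ∉ R × ∃[ w ] (w ∈ R × Adj G u w))

-- Write t = P / Q. Every claim comes from the toughness inequality P · c(G − X) ≤ Q · ∣ X ∣ for a
-- suitable cutset X, compared with ∣ S ∣ = t · c(G − S). For (i)–(iii), X = S ─ S′ keeps apart the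
-- components of G − S missed by S′, and S′ itself; for (iv), X = S ∪ T with T cutting R, where the
-- inequality is strict because S is a maximal tough-set; for (v), a cutset of the contraction is
-- pulled back to G, directly when it avoids the contracted vertex, and otherwise through
-- P₄-freeness, which makes every vertex of S adjacent to R complete to R, so that (ii) applies.

module Submission where

open import Data.Nat using (ℕ; zero; suc; _≤_; _<_; _+_; _*_; z≤n; s≤s; _≤?_; NonZero)
import Data.Nat.Properties as ℕP
open import Data.Nat.Tactic.RingSolver using (solve-∀)
open import Data.Bool using (true)
import Data.Bool as Bool
open import Data.Fin as F using (Fin; zero; suc; _≟_; splitAt; join; punchIn)
import Data.Fin.Properties as FP
open import Data.Fin.Subset
open import Data.Fin.Subset.Properties
open import Data.Vec using (_∷_; []; tabulate)
open import Data.Vec.Base using (here; there)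
import Data.Vec.Properties as VP
open import Data.Integer as ℤ using (-[1+_])
import Data.Integer.Properties as ℤP
open import Data.Rational as ℚ using (ℚ; mkℚ; 0ℚ; 1ℚ; _/_; toℚᵘ)
import Data.Rational.Properties as ℚP
open import Data.Rational.Unnormalised as ℚᵘ using (mkℚᵘ; *≡*; *≤*)
import Data.Rational.Unnormalised.Properties as ℚᵘP
open import Data.Product using (Σ; ∃; ∃-syntax; _×_; _,_; proj₁; proj₂)
open import Data.Sum using (_⊎_; inj₁; inj₂; [_,_]; [_,_]′)
open import Data.Empty using (⊥-elim)
open import Function.Base using (_∋_; _∘_)
open import Function.Definitions using (Injective)
open import Function.Bundles using (mk⇔; Equivalence)
open import Relation.Nullary using (¬_; Dec; yes; no; does)
open import Relation.Nullary.Decidable using (_×-dec_; ¬?; toSum; decidable-stable)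
open import Relation.Unary using (Pred; Decidable)
open import Relation.Binary.PropositionalEquality hiding ([_])
open import Defs hiding (sym)

private variable
  n m : ℕ

-- Finite subsets

opaque
  toSubset : ∀ {ℓ} {P : Pred (Fin n) ℓ} → Decidable P → Subset n
  toSubset P? = tabulate (λ i → does (P? i))

  ∈-toSubset⁺ : ∀ {ℓ} {P : Pred (Fin n) ℓ} (P? : Decidable P) {x} → P x → x ∈ toSubset P?
  ∈-toSubset⁺ {P = P} P? {x} px =
    VP.lookup⇒[]= x _ (trans (VP.lookup∘tabulate _ x) (does-yes (P? x)))
    where
    does-yes : (d : Dec (P x)) → does d ≡ true
    does-yes (yes _) = refl
    does-yes (no ¬p) = ⊥-elim (¬p px)

  ∈-toSubset⁻ : ∀ {ℓ} {P : Pred (Fin n) ℓ} (P? : Decidable P) {x} → x ∈ toSubset P? → P x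
  ∈-toSubset⁻ {P = P} P? {x} x∈ =
    from-does (P? x) (trans (sym (VP.lookup∘tabulate _ x)) (VP.[]=⇒lookup x∈))
    where
    from-does : (d : Dec (P x)) → does d ≡ true → P x
    from-does (yes p) _ = p
    from-does (no _) ()

x∈p─q⁻ : ∀ {p q : Subset n} {x} → x ∈ p ─ q → x ∈ p × x ∉ q
x∈p─q⁻ {p = s ∷ p} {inside ∷ q} {zero} ()
x∈p─q⁻ {p = s ∷ p} {outside ∷ q} {zero} here = here , λ ()
x∈p─q⁻ {p = s ∷ p} {b ∷ q} {suc x} (there x∈) with x∈p─q⁻ {p = p} {q} x∈
... | x∈p , x∉q = there x∈p , λ { (there x∈q) → x∉q x∈q }

⊤─p≡∁p : (p : Subset n) → ⊤ ─ p ≡ ∁ p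
⊤─p≡∁p [] = refl
⊤─p≡∁p (inside ∷ p) = cong (outside ∷_) (⊤─p≡∁p p)
⊤─p≡∁p (outside ∷ p) = cong (inside ∷_) (⊤─p≡∁p p)

members : (p : Subset n) → Fin ∣ p ∣ → Fin n
members (inside ∷ p) zero = zero
members (inside ∷ p) (suc i) = suc (members p i)
members (outside ∷ p) i = suc (members p i)

members-∈ : (p : Subset n) (i : Fin ∣ p ∣) → members p i ∈ p
members-∈ (inside ∷ p) zero = here
members-∈ (inside ∷ p) (suc i) = there (members-∈ p i)
members-∈ (outside ∷ p) i = there (members-∈ p i)

members-injective : (p : Subset n) → Injective _≡_ _≡_ (members p)
members-injective (inside ∷ p) {zero} {zero} eq = refl
members-injective (inside ∷ p) {zero} {suc j} ()
members-injective (inside ∷ p) {suc i} {zero} ()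
members-injective (inside ∷ p) {suc i} {suc j} eq =
  cong suc (members-injective p (FP.suc-injective eq))
members-injective (outside ∷ p) eq = members-injective p (FP.suc-injective eq)

index : (p : Subset n) {x : Fin n} → x ∈ p → Fin ∣ p ∣
index (inside ∷ p) here = zero
index (inside ∷ p) (there x∈) = suc (index p x∈)
index (outside ∷ p) (there x∈) = index p x∈

members-index : (p : Subset n) {x : Fin n} (x∈ : x ∈ p) → members p (index p x∈) ≡ x
members-index (inside ∷ p) here = refl
members-index (inside ∷ p) (there x∈) = cong suc (members-index p x∈)
members-index (outside ∷ p) (there x∈) = cong suc (members-index p x∈)

injective⇒≤∣p∣ : (p : Subset n) (f : Fin m → Fin n) → Injective _≡_ _≡_ f →
                 (∀ i → f i ∈ p) → m ≤ ∣ p ∣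
injective⇒≤∣p∣ p f f-inj f∈ = FP.injective⇒≤ {f = λ i → index p (f∈ i)} λ {i} {j} eq →
  f-inj (trans (sym (members-index p (f∈ i)))
        (trans (cong (members p) eq) (members-index p (f∈ j))))

∣p─q∣+∣q∣≡∣p∣ : (p q : Subset n) → q ⊆ p → ∣ p ─ q ∣ + ∣ q ∣ ≡ ∣ p ∣
∣p─q∣+∣q∣≡∣p∣ [] [] _ = refl
∣p─q∣+∣q∣≡∣p∣ (inside ∷ p) (inside ∷ q) q⊆p =
  trans (ℕP.+-suc _ _) (cong suc (∣p─q∣+∣q∣≡∣p∣ p q (drop-∷-⊆ q⊆p)))
∣p─q∣+∣q∣≡∣p∣ (outside ∷ p) (inside ∷ q) q⊆p with q⊆p here
... | ()
∣p─q∣+∣q∣≡∣p∣ (inside ∷ p) (outside ∷ q) q⊆p = cong suc (∣p─q∣+∣q∣≡∣p∣ p q (drop-∷-⊆ q⊆p))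
∣p─q∣+∣q∣≡∣p∣ (outside ∷ p) (outside ∷ q) q⊆p = ∣p─q∣+∣q∣≡∣p∣ p q (drop-∷-⊆ q⊆p)

∣p∪q∣≤∣p∣+∣q∣ : (p q : Subset n) → ∣ p ∪ q ∣ ≤ ∣ p ∣ + ∣ q ∣
∣p∪q∣≤∣p∣+∣q∣ [] [] = z≤n
∣p∪q∣≤∣p∣+∣q∣ (inside ∷ p) (inside ∷ q) =
  s≤s (ℕP.≤-trans (∣p∪q∣≤∣p∣+∣q∣ p q)
      (ℕP.≤-trans (ℕP.n≤1+n _) (ℕP.≤-reflexive (sym (ℕP.+-suc _ _)))))
∣p∪q∣≤∣p∣+∣q∣ (inside ∷ p) (outside ∷ q) = s≤s (∣p∪q∣≤∣p∣+∣q∣ p q)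
∣p∪q∣≤∣p∣+∣q∣ (outside ∷ p) (inside ∷ q) =
  ℕP.≤-trans (s≤s (∣p∪q∣≤∣p∣+∣q∣ p q)) (ℕP.≤-reflexive (sym (ℕP.+-suc _ _)))
∣p∪q∣≤∣p∣+∣q∣ (outside ∷ p) (outside ∷ q) = ∣p∪q∣≤∣p∣+∣q∣ p q

disjoint⇒∣p∪q∣≡∣p∣+∣q∣ : (p q : Subset n) → (∀ {x} → x ∈ p → x ∉ q) →
                          ∣ p ∪ q ∣ ≡ ∣ p ∣ + ∣ q ∣
disjoint⇒∣p∪q∣≡∣p∣+∣q∣ [] [] _ = refl
disjoint⇒∣p∪q∣≡∣p∣+∣q∣ (inside ∷ p) (inside ∷ q) disj = ⊥-elim (disj here here)
disjoint⇒∣p∪q∣≡∣p∣+∣q∣ (inside ∷ p) (outside ∷ q) disj =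
  cong suc (disjoint⇒∣p∪q∣≡∣p∣+∣q∣ p q λ x∈p x∈q → disj (there x∈p) (there x∈q))
disjoint⇒∣p∪q∣≡∣p∣+∣q∣ (outside ∷ p) (inside ∷ q) disj =
  trans (cong suc (disjoint⇒∣p∪q∣≡∣p∣+∣q∣ p q λ x∈p x∈q → disj (there x∈p) (there x∈q)))
        (sym (ℕP.+-suc _ _))
disjoint⇒∣p∪q∣≡∣p∣+∣q∣ (outside ∷ p) (outside ∷ q) disj =
  disjoint⇒∣p∪q∣≡∣p∣+∣q∣ p q λ x∈p x∈q → disj (there x∈p) (there x∈q)

∣p∣+∣∁p∣≡n : (p : Subset n) → ∣ p ∣ + ∣ ∁ p ∣ ≡ n
∣p∣+∣∁p∣≡n [] = refl
∣p∣+∣∁p∣≡n (inside ∷ p) = cong suc (∣p∣+∣∁p∣≡n p)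
∣p∣+∣∁p∣≡n (outside ∷ p) = trans (ℕP.+-suc _ _) (cong suc (∣p∣+∣∁p∣≡n p))

-- Walks in induced subgraphs

module Walk (A : Fin n → Fin n → Set) where

  StepClosed : Subset n → Subset n → Set
  StepClosed W C = ∀ {x y} → x ∈ C → y ∈ W → A x y → y ∈ C

  Reach-head∈ : ∀ {W u v} → Reach A W u v → u ∈ W
  Reach-head∈ (here u∈) = u∈
  Reach-head∈ (step u∈ _ _) = u∈

  Reach-last∈ : ∀ {W u v} → Reach A W u v → v ∈ W
  Reach-last∈ (here v∈) = v∈
  Reach-last∈ (step _ _ r) = Reach-last∈ r

  Reach-mono : ∀ {W W′ u v} → W ⊆ W′ → Reach A W u v → Reach A W′ u v
  Reach-mono W⊆ (here u∈) = here (W⊆ u∈)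
  Reach-mono W⊆ (step u∈ a r) = step (W⊆ u∈) a (Reach-mono W⊆ r)

  Reach-trans : ∀ {W u v w} → Reach A W u v → Reach A W v w → Reach A W u w
  Reach-trans (here _) r = r
  Reach-trans (step u∈ a r) r′ = step u∈ a (Reach-trans r r′)

  Reach-edge : ∀ {W u v} → u ∈ W → v ∈ W → A u v → Reach A W u v
  Reach-edge u∈ v∈ a = step u∈ a (here v∈)

  Reach-closed : ∀ {W} C → StepClosed W C → ∀ {u v} → Reach A W u v → u ∈ C → v ∈ C
  Reach-closed C cl (here _) u∈ = u∈
  Reach-closed C cl (step _ a r) u∈ = Reach-closed C cl r (cl u∈ (Reach-head∈ r) a)

  Reach-restrict : ∀ {W} C → StepClosed W C → ∀ {u v} → Reach A W u v → u ∈ C → Reach A C u v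
  Reach-restrict C cl (here _) u∈ = here u∈
  Reach-restrict C cl (step _ a r) u∈ =
    step u∈ a (Reach-restrict C cl r (cl u∈ (Reach-head∈ r) a))

  Reach-map : ∀ {W} (B : Fin n → Fin n → Set) → (∀ {x y} → x ∈ W → y ∈ W → A x y → B x y) →
              ∀ {u v} → Reach A W u v → Reach B W u v
  Reach-map B f (here u∈) = here u∈
  Reach-map B f (step u∈ a r) = step u∈ (f u∈ (Reach-head∈ r) a) (Reach-map B f r)

  Reach-exit : ∀ {W} D → ∀ {u v} → Reach A W u v → u ∈ D →
               Reach A D u v ⊎ ∃[ x ] ∃[ y ] (Reach A D u x × A x y × y ∈ W × y ∉ D)
  Reach-exit D (here _) u∈ = inj₁ (here u∈)
  Reach-exit D {u} (step {v = w} _ a r) u∈ with w ∈? D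
  ... | no w∉ = inj₂ (u , w , here u∈ , a , Reach-head∈ r , w∉)
  ... | yes w∈ with Reach-exit D r w∈
  ...   | inj₁ r′ = inj₁ (step u∈ a r′)
  ...   | inj₂ (x , y , r′ , a′ , y∈ , y∉) = inj₂ (x , y , step u∈ a r′ , a′ , y∈ , y∉)

module WalkInGraph (G : Graph n) where

  open Walk (Adj G)

  Reach-snoc : ∀ {W u v w} → Reach (Adj G) W u v → Adj G v w → w ∈ W → Reach (Adj G) W u w
  Reach-snoc r a w∈ = Reach-trans r (Reach-edge (Reach-last∈ r) w∈ a)

  Reach-sym : ∀ {W u v} → Reach (Adj G) W u v → Reach (Adj G) W v u
  Reach-sym (here u∈) = here u∈
  Reach-sym (step u∈ a r) = Reach-snoc (Reach-sym r) (Graph.sym G a) u∈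

  private
    Reach-split : ∀ {W} u {x v} → Reach (Adj G) W x v →
      Reach (Adj G) (W - u) x v ⊎ u ≡ v ⊎ ∃[ w ] (Adj G u w × Reach (Adj G) (W - u) w v)
    Reach-split u {x} (here x∈) with x ≟ u
    ... | yes refl = inj₂ (inj₁ refl)
    ... | no x≢u = inj₁ (here (x∈p∧x≢y⇒x∈p-y x∈ x≢u))
    Reach-split u {x} (step {v = y} x∈ a r) with Reach-split u r
    ... | inj₂ z = inj₂ z
    ... | inj₁ r′ with x ≟ u
    ...   | yes refl = inj₂ (inj₂ (y , a , r′))
    ...   | no x≢u = inj₁ (step (x∈p∧x≢y⇒x∈p-y x∈ x≢u) a r′)

    Reach?-bounded : ∀ k W → ∣ W ∣ ≤ k → ∀ u v → Dec (Reach (Adj G) W u v)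
    Reach?-bounded k W ∣W∣≤k u v with u ∈? W
    ... | no u∉ = no λ r → u∉ (Reach-head∈ r)
    Reach?-bounded k W ∣W∣≤k u v | yes u∈ with u ≟ v
    ... | yes refl = yes (here u∈)
    Reach?-bounded zero W ∣W∣≤k u v | yes u∈ | no u≢v =
      ⊥-elim (ℕP.<⇒≱ (ℕP.<-≤-trans (x∈p⇒∣p-x∣<∣p∣ u∈) ∣W∣≤k) z≤n)
    Reach?-bounded (suc k) W ∣W∣≤k u v | yes u∈ | no u≢v
      with FP.any? (λ w → dec G u w ×-dec Reach?-bounded k (W - u) ∣W-u∣≤k w v)
      where
      ∣W-u∣≤k : ∣ W - u ∣ ≤ k
      ∣W-u∣≤k = ℕP.≤-pred (ℕP.<-≤-trans (x∈p⇒∣p-x∣<∣p∣ u∈) ∣W∣≤k)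
    ... | yes (w , a , r) = yes (step u∈ a (Reach-mono (λ x∈ → proj₁ (x∈p─q⁻ x∈)) r))
    ... | no ¬w = no λ r → ¬split (Reach-split u r)
      where
      ¬split : ¬ (Reach (Adj G) (W - u) u v ⊎ u ≡ v ⊎ ∃[ w ] (Adj G u w × Reach (Adj G) (W - u) w v))
      ¬split (inj₁ r′) = proj₂ (x∈p─q⁻ (Reach-head∈ r′)) (x∈⁅x⁆ u)
      ¬split (inj₂ (inj₁ u≡v)) = u≢v u≡v
      ¬split (inj₂ (inj₂ w-path)) = ¬w w-path

  Reach? : ∀ W u v → Dec (Reach (Adj G) W u v)
  Reach? W = Reach?-bounded ∣ W ∣ W ℕP.≤-refl

-- Counting equivalence classes and components

Classified : (P : Fin n → Set) (E : Fin n → Fin n → Set) → ℕ → Set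
Classified {n} P E k = Σ (Fin n → Fin k) λ f → (∀ i → ∃ λ v → P v × f v ≡ i) ×
  (∀ u v → P u → P v → (f u ≡ f v → E u v) × (E u v → f u ≡ f v))

-- induction on n: vertex zero lies outside P, or joins the class of a later vertex, or is a new class
classify : (P : Fin n → Set) → (∀ x → Dec (P x)) →
  (E : Fin n → Fin n → Set) → (∀ u v → Dec (E u v)) →
  (∀ {u} → P u → E u u) → (∀ {u v} → E u v → E v u) → (∀ {u v w} → E u v → E v w → E u w) →
  ∃ P → ∃ λ k → Classified P E k
classify {zero} P P? E E? Er Es Et (() , _)
classify {suc n} P P? E E? Er Es Et (x₀ , px₀) with FP.any? (λ i → P? (suc i))
... | no ¬P′ = 1 , (λ _ → zero) , (λ { zero → zero , p0 , refl }) ,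
        λ u v pu pv → (λ _ → subst₂ E (sym (is0 u pu)) (sym (is0 v pv)) (Er p0)) , (λ _ → refl)
  where
  is0 : ∀ u → P u → u ≡ zero
  is0 zero _ = refl
  is0 (suc u) pu = ⊥-elim (¬P′ (u , pu))
  p0 : P zero
  p0 = subst P (is0 x₀ px₀) px₀
... | yes w with classify (λ i → P (suc i)) (λ i → P? (suc i)) (λ i j → E (suc i) (suc j))
                          (λ i j → E? (suc i) (suc j)) Er Es Et w
... | k , f′ , surj′ , eqv′ with P? zero
...   | no ¬p0 = k , f , surj , eqv
  where
  f : Fin (suc n) → Fin k
  f zero = f′ (proj₁ w)
  f (suc i) = f′ i
  surj : ∀ i → ∃ λ v → P v × f v ≡ i
  surj i with surj′ i
  ... | v , pv , eq = suc v , pv , eq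
  eqv : ∀ u v → P u → P v → (f u ≡ f v → E u v) × (E u v → f u ≡ f v)
  eqv zero _ pu _ = ⊥-elim (¬p0 pu)
  eqv (suc u) zero _ pv = ⊥-elim (¬p0 pv)
  eqv (suc u) (suc v) pu pv = eqv′ u v pu pv
...   | yes p0 with FP.any? (λ j → P? (suc j) ×-dec E? zero (suc j))
...     | yes (j₀ , pj₀ , e0j₀) = k , f , surj , eqv
  where
  f : Fin (suc n) → Fin k
  f zero = f′ j₀
  f (suc i) = f′ i
  surj : ∀ i → ∃ λ v → P v × f v ≡ i
  surj i with surj′ i
  ... | v , pv , eq = suc v , pv , eq
  eqv : ∀ u v → P u → P v → (f u ≡ f v → E u v) × (E u v → f u ≡ f v)
  eqv zero zero pu pv = (λ _ → Er p0) , (λ _ → refl)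
  eqv zero (suc v) pu pv = (λ eq → Et e0j₀ (proj₁ (eqv′ j₀ v pj₀ pv) eq)) ,
                           (λ e → proj₂ (eqv′ j₀ v pj₀ pv) (Et (Es e0j₀) e))
  eqv (suc u) zero pu pv = (λ eq → Es (Et e0j₀ (proj₁ (eqv′ j₀ u pj₀ pu) (sym eq)))) ,
                           (λ e → sym (proj₂ (eqv′ j₀ u pj₀ pu) (Et (Es e0j₀) (Es e))))
  eqv (suc u) (suc v) pu pv = eqv′ u v pu pv
...     | no ¬j = suc k , f , surj , eqv
  where
  f : Fin (suc n) → Fin (suc k)
  f zero = zero
  f (suc i) = suc (f′ i)
  surj : ∀ i → ∃ λ v → P v × f v ≡ i
  surj zero = zero , p0 , refl
  surj (suc i) with surj′ i
  ... | v , pv , eq = suc v , pv , cong suc eq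
  eqv : ∀ u v → P u → P v → (f u ≡ f v → E u v) × (E u v → f u ≡ f v)
  eqv zero zero pu pv = (λ _ → Er p0) , (λ _ → refl)
  eqv zero (suc v) pu pv = (λ ()) , (λ e → ⊥-elim (¬j (v , pv , e)))
  eqv (suc u) zero pu pv = (λ ()) , (λ e → ⊥-elim (¬j (u , pu , Es e)))
  eqv (suc u) (suc v) pu pv = (λ eq → proj₁ (eqv′ u v pu pv) (FP.suc-injective eq)) ,
                              (λ e → cong suc (proj₂ (eqv′ u v pu pv) e))

module Components {A : Fin n → Fin n → Set} {W : Subset n} {k : ℕ}
                  (nc : NumComponents A W k) where

  label : Fin n → Fin k
  label = proj₁ nc

  rep : Fin k → Fin n
  rep i = proj₁ (proj₁ (proj₂ nc) i)

  rep∈ : ∀ i → rep i ∈ W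
  rep∈ i = proj₁ (proj₂ (proj₁ (proj₂ nc) i))

  label-rep : ∀ i → label (rep i) ≡ i
  label-rep i = proj₂ (proj₂ (proj₁ (proj₂ nc) i))

  label≡⇒Reach : ∀ {u v} → u ∈ W → v ∈ W → label u ≡ label v → Reach A W u v
  label≡⇒Reach {u} {v} u∈ v∈ = Equivalence.to (proj₂ (proj₂ nc) u v u∈ v∈)

  Reach⇒label≡ : ∀ {u v} → Reach A W u v → label u ≡ label v
  Reach⇒label≡ {u} {v} r =
    Equivalence.from (proj₂ (proj₂ nc) u v (Walk.Reach-head∈ A r) (Walk.Reach-last∈ A r)) r

  Reach-rep⇒≡ : ∀ {i j} → Reach A W (rep i) (rep j) → i ≡ j
  Reach-rep⇒≡ {i} {j} r = trans (sym (label-rep i)) (trans (Reach⇒label≡ r) (label-rep j))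

module ComponentsInGraph (G : Graph n) where

  open Walk (Adj G)
  open WalkInGraph G

  opaque
    numComponents : (W : Subset n) → Nonempty W → ∃ λ k → NumComponents (Adj G) W k
    numComponents W ne
      with classify (_∈ W) (_∈? W) (Reach (Adj G) W) (Reach? W) here Reach-sym Reach-trans ne
    ... | k , f , surj , eqv =
      k , f , surj , λ u v u∈ v∈ → mk⇔ (proj₁ (eqv u v u∈ v∈)) (proj₂ (eqv u v u∈ v∈))

  module _ {W : Subset n} {k : ℕ} (nc : NumComponents (Adj G) W k) where
    open Components nc

    separated⇒≤ : (g : Fin m → Fin n) → (∀ i j → Reach (Adj G) W (g i) (g j) → i ≡ j) →
                  (∀ i → g i ∈ W) → m ≤ k
    separated⇒≤ g sep g∈ = FP.injective⇒≤ {f = λ i → label (g i)} λ {i} {j} eq →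
      sep i j (label≡⇒Reach (g∈ i) (g∈ j) eq)

    separated₂⇒+≤ : ∀ {a b} (g₁ : Fin a → Fin n) (g₂ : Fin b → Fin n) →
      (∀ i j → Reach (Adj G) W (g₁ i) (g₁ j) → i ≡ j) →
      (∀ i j → Reach (Adj G) W (g₂ i) (g₂ j) → i ≡ j) →
      (∀ i j → ¬ Reach (Adj G) W (g₁ i) (g₂ j)) →
      (∀ i → g₁ i ∈ W) → (∀ i → g₂ i ∈ W) → a + b ≤ k
    separated₂⇒+≤ {a} {b} g₁ g₂ sep₁ sep₂ sep₁₂ g₁∈ g₂∈ = separated⇒≤ g sep g∈
      where
      g⊎ : Fin a ⊎ Fin b → Fin n
      g⊎ = [ g₁ , g₂ ]
      g : Fin (a + b) → Fin n
      g i = g⊎ (splitAt a i)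
      sep⊎ : ∀ x y → Reach (Adj G) W (g⊎ x) (g⊎ y) → x ≡ y
      sep⊎ (inj₁ i) (inj₁ j) r = cong inj₁ (sep₁ i j r)
      sep⊎ (inj₂ i) (inj₂ j) r = cong inj₂ (sep₂ i j r)
      sep⊎ (inj₁ i) (inj₂ j) r = ⊥-elim (sep₁₂ i j r)
      sep⊎ (inj₂ i) (inj₁ j) r = ⊥-elim (sep₁₂ j i (Reach-sym r))
      sep : ∀ i j → Reach (Adj G) W (g i) (g j) → i ≡ j
      sep i j r = trans (sym (FP.join-splitAt a b i))
        (trans (cong (join a b) (sep⊎ (splitAt a i) (splitAt a j) r)) (FP.join-splitAt a b j))
      g∈ : ∀ i → g i ∈ W
      g∈ i with splitAt a i
      ... | inj₁ x = g₁∈ x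
      ... | inj₂ y = g₂∈ y

    connected⇒≤1 : (∀ u v → u ∈ W → v ∈ W → Reach (Adj G) W u v) → k ≤ 1
    connected⇒≤1 conn = FP.injective⇒≤ {f = λ (_ : Fin k) → (Fin 1 ∋ zero)} λ {i} {j} _ →
      Reach-rep⇒≡ (conn _ _ (rep∈ i) (rep∈ j))

-- Comparing multiples of a nonnegative rational t = P / Q with naturals

nonNeg⇒fraction : ∀ t → 0ℚ ℚ.≤ t → ∃ λ P → ∃ λ Q-1 → toℚᵘ t ≡ mkℚᵘ (ℤ.+ P) Q-1
nonNeg⇒fraction (mkℚ (ℤ.+ P) Q-1 _) _ = P , Q-1 , refl
nonNeg⇒fraction (mkℚ -[1+ k ] Q-1 _) (ℚ.*≤* 0≤t) =
  ⊥-elim (0≰neg (subst₂ ℤ._≤_ (ℤP.*-zeroˡ (ℤ.+ suc Q-1)) (ℤP.*-identityʳ -[1+ k ]) 0≤t))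
  where
  0≰neg : ¬ (ℤ.+ 0 ℤ.≤ -[1+ k ])
  0≰neg ()

toℚᵘ-ℕ→ℚ : ∀ a → toℚᵘ (ℕ→ℚ a) ℚᵘ.≃ mkℚᵘ (ℤ.+ a) 0
toℚᵘ-ℕ→ℚ a = ℚP.toℚᵘ-fromℚᵘ (mkℚᵘ (ℤ.+ a) 0)

toℚᵘ-1/k : ∀ k → toℚᵘ (ℤ.+ 1 / suc k) ℚᵘ.≃ mkℚᵘ (ℤ.+ 1) k
toℚᵘ-1/k k = ℚP.toℚᵘ-fromℚᵘ (mkℚᵘ (ℤ.+ 1) k)

+*+ : ∀ a b → ℤ.+ a ℤ.* ℤ.+ b ≡ ℤ.+ (a * b)
+*+ a b = sym (ℤP.pos-* a b)

module Fraction (t : ℚ) (P Q-1 : ℕ) (t≡P/Q : toℚᵘ t ≡ mkℚᵘ (ℤ.+ P) Q-1) where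

  Q : ℕ
  Q = suc Q-1

  affine : ℕ → ℕ → ℚ
  affine a b = t ℚ.* ℕ→ℚ a ℚ.+ ℕ→ℚ b

  private
    affine≃ : ∀ a b → toℚᵘ (affine a b) ℚᵘ.≃ mkℚᵘ (ℤ.+ (P * a + Q * b)) Q-1
    affine≃ a b =
      ℚᵘP.≃-trans (ℚP.toℚᵘ-homo-+ (t ℚ.* ℕ→ℚ a) (ℕ→ℚ b))
      (ℚᵘP.≃-trans (ℚᵘP.+-cong (ℚᵘP.≃-trans (ℚP.toℚᵘ-homo-* t (ℕ→ℚ a))
                                             (ℚᵘP.*-cong (ℚᵘP.≃-reflexive t≡P/Q) (toℚᵘ-ℕ→ℚ a)))
                               (toℚᵘ-ℕ→ℚ b))
      (*≡* cross))
      where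
      open ≡-Reasoning
      normalise : ∀ P a b Q → (P * a * 1 + b * (Q * 1)) * Q ≡ (P * a + Q * b) * (Q * 1 * 1)
      normalise = solve-∀
      cross : ((ℤ.+ P ℤ.* ℤ.+ a) ℤ.* ℤ.+ 1 ℤ.+ ℤ.+ b ℤ.* ℤ.+ (Q * 1)) ℤ.* ℤ.+ Q
              ≡ ℤ.+ (P * a + Q * b) ℤ.* ℤ.+ (Q * 1 * 1)
      cross = begin
        ((ℤ.+ P ℤ.* ℤ.+ a) ℤ.* ℤ.+ 1 ℤ.+ ℤ.+ b ℤ.* ℤ.+ (Q * 1)) ℤ.* ℤ.+ Q
          ≡⟨ cong (λ z → (z ℤ.* ℤ.+ 1 ℤ.+ ℤ.+ b ℤ.* ℤ.+ (Q * 1)) ℤ.* ℤ.+ Q) (+*+ P a) ⟩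
        (ℤ.+ (P * a) ℤ.* ℤ.+ 1 ℤ.+ ℤ.+ b ℤ.* ℤ.+ (Q * 1)) ℤ.* ℤ.+ Q
          ≡⟨ cong₂ (λ z w → (z ℤ.+ w) ℤ.* ℤ.+ Q) (+*+ (P * a) 1) (+*+ b (Q * 1)) ⟩
        ℤ.+ (P * a * 1 + b * (Q * 1)) ℤ.* ℤ.+ Q
          ≡⟨ +*+ (P * a * 1 + b * (Q * 1)) Q ⟩
        ℤ.+ ((P * a * 1 + b * (Q * 1)) * Q)
          ≡⟨ cong ℤ.+_ (normalise P a b Q) ⟩
        ℤ.+ ((P * a + Q * b) * (Q * 1 * 1))
          ≡⟨ sym (+*+ (P * a + Q * b) (Q * 1 * 1)) ⟩
        ℤ.+ (P * a + Q * b) ℤ.* ℤ.+ (Q * 1 * 1)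
          ∎

  affine-≤⇒ : ∀ a b c d → affine a b ℚ.≤ affine c d → P * a + Q * b ≤ P * c + Q * d
  affine-≤⇒ a b c d le
    with ℚᵘP.≤-respʳ-≃ (affine≃ c d) (ℚᵘP.≤-respˡ-≃ (affine≃ a b) (ℚP.toℚᵘ-mono-≤ le))
  ... | *≤* z = ℤP.drop‿+≤+ (ℤP.*-cancelʳ-≤-pos _ _ (ℤ.+ Q) z)

  affine-≤⇐ : ∀ a b c d → P * a + Q * b ≤ P * c + Q * d → affine a b ℚ.≤ affine c d
  affine-≤⇐ a b c d le = ℚP.toℚᵘ-cancel-≤
    (ℚᵘP.≤-respʳ-≃ (ℚᵘP.≃-sym (affine≃ c d)) (ℚᵘP.≤-respˡ-≃ (ℚᵘP.≃-sym (affine≃ a b))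
      (*≤* (ℤP.*-monoʳ-≤-nonNeg (ℤ.+ Q) (ℤ.+≤+ le)))))

  private
    affine-m0 : ∀ m → affine m 0 ≡ t ℚ.* ℕ→ℚ m
    affine-m0 m = ℚP.+-identityʳ (t ℚ.* ℕ→ℚ m)

    affine-0n : ∀ n → affine 0 n ≡ ℕ→ℚ n
    affine-0n n = trans (cong (ℚ._+ ℕ→ℚ n) (ℚP.*-zeroʳ t)) (ℚP.+-identityˡ (ℕ→ℚ n))

    affine-1n : ∀ n → affine 1 n ≡ ℕ→ℚ n ℚ.+ t
    affine-1n n = trans (cong (ℚ._+ ℕ→ℚ n) (ℚP.*-identityʳ t)) (ℚP.+-comm t (ℕ→ℚ n))

    P*m+Q*0≡P*m : ∀ P m Q → P * m + Q * 0 ≡ P * m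
    P*m+Q*0≡P*m = solve-∀

    P*0+Q*n≡Q*n : ∀ P Q n → P * 0 + Q * n ≡ Q * n
    P*0+Q*n≡Q*n = solve-∀

    P*1+Q*n≡Q*n+P : ∀ P Q n → P * 1 + Q * n ≡ Q * n + P
    P*1+Q*n≡Q*n+P = solve-∀

  t*m≤n⇒P*m≤Q*n : ∀ m n → t ℚ.* ℕ→ℚ m ℚ.≤ ℕ→ℚ n → P * m ≤ Q * n
  t*m≤n⇒P*m≤Q*n m n le = subst₂ _≤_ (P*m+Q*0≡P*m P m Q) (P*0+Q*n≡Q*n P Q n)
    (affine-≤⇒ m 0 0 n (subst₂ ℚ._≤_ (sym (affine-m0 m)) (sym (affine-0n n)) le))

  P*m≤Q*n⇒t*m≤n : ∀ m n → P * m ≤ Q * n → t ℚ.* ℕ→ℚ m ℚ.≤ ℕ→ℚ n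
  P*m≤Q*n⇒t*m≤n m n le = subst₂ ℚ._≤_ (affine-m0 m) (affine-0n n)
    (affine-≤⇐ m 0 0 n (subst₂ _≤_ (sym (P*m+Q*0≡P*m P m Q)) (sym (P*0+Q*n≡Q*n P Q n)) le))

  n≤t*m⇒Q*n≤P*m : ∀ n m → ℕ→ℚ n ℚ.≤ t ℚ.* ℕ→ℚ m → Q * n ≤ P * m
  n≤t*m⇒Q*n≤P*m n m le = subst₂ _≤_ (P*0+Q*n≡Q*n P Q n) (P*m+Q*0≡P*m P m Q)
    (affine-≤⇒ 0 n m 0 (subst₂ ℚ._≤_ (sym (affine-0n n)) (sym (affine-m0 m)) le))

  Q*n≤P*m⇒n≤t*m : ∀ n m → Q * n ≤ P * m → ℕ→ℚ n ℚ.≤ t ℚ.* ℕ→ℚ m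
  Q*n≤P*m⇒n≤t*m n m le = subst₂ ℚ._≤_ (affine-0n n) (affine-m0 m)
    (affine-≤⇐ 0 n m 0 (subst₂ _≤_ (sym (P*0+Q*n≡Q*n P Q n)) (sym (P*m+Q*0≡P*m P m Q)) le))

  Q*n+P≤P*m⇒n+t≤t*m : ∀ n m → Q * n + P ≤ P * m → ℕ→ℚ n ℚ.+ t ℚ.≤ t ℚ.* ℕ→ℚ m
  Q*n+P≤P*m⇒n+t≤t*m n m le = subst₂ ℚ._≤_ (affine-1n n) (affine-m0 m)
    (affine-≤⇐ 1 n m 0 (subst₂ _≤_ (sym (P*1+Q*n≡Q*n+P P Q n)) (sym (P*m+Q*0≡P*m P m Q)) le))

  n≡t*m⇒Q*n≡P*m : ∀ n m → ℕ→ℚ n ≡ t ℚ.* ℕ→ℚ m → Q * n ≡ P * m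
  n≡t*m⇒Q*n≡P*m n m eq = ℕP.≤-antisym (n≤t*m⇒Q*n≤P*m n m (ℚP.≤-reflexive eq))
                                      (t*m≤n⇒P*m≤Q*n m n (ℚP.≤-reflexive (sym eq)))

  Q*n≡P*m⇒n≡t*m : ∀ n m → Q * n ≡ P * m → ℕ→ℚ n ≡ t ℚ.* ℕ→ℚ m
  Q*n≡P*m⇒n≡t*m n m eq = ℚP.≤-antisym (Q*n≤P*m⇒n≤t*m n m (ℕP.≤-reflexive eq))
                                      (P*m≤Q*n⇒t*m≤n m n (ℕP.≤-reflexive (sym eq)))

  t≤1⇒P≤Q : t ℚ.≤ 1ℚ → P ≤ Q
  t≤1⇒P≤Q le = subst₂ _≤_ (trans (P*m+Q*0≡P*m P 1 Q) (ℕP.*-identityʳ P))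
                           (trans (P*0+Q*n≡Q*n P Q 1) (ℕP.*-identityʳ Q))
    (affine-≤⇒ 1 0 0 1 (subst₂ ℚ._≤_ (sym (trans (affine-m0 1) (ℚP.*-identityʳ t)))
                                     (sym (affine-0n 1)) le))

  1/k≤t⇒Q≤P*k : ∀ k → (ℤ.+ 1 / suc k) ℚ.≤ t → Q ≤ P * suc k
  1/k≤t⇒Q≤P*k k le
    with ℚᵘP.≤-respʳ-≃ (ℚᵘP.≃-reflexive t≡P/Q) (ℚᵘP.≤-respˡ-≃ (toℚᵘ-1/k k) (ℚP.toℚᵘ-mono-≤ le))
  ... | *≤* z = subst₂ _≤_ (ℕP.+-identityʳ Q) refl
                  (ℤP.drop‿+≤+ (subst₂ ℤ._≤_ (+*+ 1 Q) (+*+ P (suc k)) z))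

m≤n*k⇒1/k*m≤n : ∀ k m n → m ≤ n * suc k → (ℤ.+ 1 / suc k) ℚ.* ℕ→ℚ m ℚ.≤ ℕ→ℚ n
m≤n*k⇒1/k*m≤n k m n le = ℚP.toℚᵘ-cancel-≤
  (ℚᵘP.≤-respʳ-≃ (ℚᵘP.≃-sym (toℚᵘ-ℕ→ℚ n)) (ℚᵘP.≤-respˡ-≃ (ℚᵘP.≃-sym
     (ℚᵘP.≃-trans (ℚP.toℚᵘ-homo-* (ℤ.+ 1 / suc k) (ℕ→ℚ m))
                  (ℚᵘP.*-cong (toℚᵘ-1/k k) (toℚᵘ-ℕ→ℚ m))))
   (*≤* (subst₂ ℤ._≤_ (sym (trans (cong (ℤ._* ℤ.+ 1) (+*+ 1 m)) (+*+ (1 * m) 1)))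
                      (sym (+*+ n (suc k * 1)))
          (ℤ.+≤+ (subst₂ _≤_ (sym (1*m*1≡m m)) (cong (n *_) (sym (ℕP.*-identityʳ (suc k)))) le))))))
  where
  1*m*1≡m : ∀ m → 1 * m * 1 ≡ m
  1*m*1≡m = solve-∀

0≤1/k : ∀ k → 0ℚ ℚ.≤ (ℤ.+ 1 / suc k)
0≤1/k k = ℚP.toℚᵘ-cancel-≤ (ℚᵘP.≤-respʳ-≃ (ℚᵘP.≃-sym (toℚᵘ-1/k k)) (*≤* (ℤ.+≤+ z≤n)))

-- Properties of a tough-set

Toughness≡-unique : ∀ {t t′} (G : Graph n) → Toughness≡ G t → Toughness≡ G t′ → t′ ≡ t
Toughness≡-unique G (tough , max) (tough′ , max′) = ℚP.≤-antisym (max _ tough′) (max′ _ tough)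

AdjToAtLeast-≤ : ∀ (G : Graph n) {S X m k} → k ≤ m → AdjToAtLeast G S X m → AdjToAtLeast G S X k
AdjToAtLeast-≤ G k≤m (Rs , Rs-inj , Rs-ok) =
  (λ i → Rs (F.inject≤ i k≤m)) , (λ eq → FP.inject≤-injective k≤m k≤m _ _ (Rs-inj eq)) , (λ i → Rs-ok _)

x∈p∧y∉p⇒x≢y : ∀ {p : Subset n} {x y} → x ∈ p → y ∉ p → x ≢ y
x∈p∧y∉p⇒x≢y x∈p y∉p refl = y∉p x∈p

x∉p∧y∈p⇒x≢y : ∀ {p : Subset n} {x y} → x ∉ p → y ∈ p → x ≢ y
x∉p∧y∈p⇒x≢y x∉p y∈p refl = x∉p y∈p

IsComponent-unique : ∀ {A : Fin n → Fin n → Set} {W C C′ y} →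
  IsComponent A W C → IsComponent A W C′ → y ∈ C → y ∈ C′ → C ≡ C′
IsComponent-unique (_ , _ , conn , closed) (_ , _ , conn′ , closed′) y∈C y∈C′ =
  ⊆-antisym (λ {z} z∈ → closed′ _ z y∈C′ (conn _ z y∈C z∈))
            (λ {z} z∈ → closed _ z y∈C (conn′ _ z y∈C′ z∈))

module ToughSetProperties (G : Graph n) (t : ℚ) (τ≡t : Toughness≡ G t) (t≤1 : t ℚ.≤ 1ℚ)
  (S : Subset n) (c₁ : ℕ) (ncS : NumComponents (Adj G) (∁ S) (2 + c₁))
  (∣S∣≡t*c : ℕ→ℚ ∣ S ∣ ≡ t ℚ.* ℕ→ℚ (2 + c₁)) where

  A : Fin n → Fin n → Set
  A = Adj G

  open Walk A
  open WalkInGraph G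
  open ComponentsInGraph G
  open Components ncS

  c : ℕ
  c = 2 + c₁

  private
    fraction : ∃ λ P → ∃ λ Q-1 → toℚᵘ t ≡ mkℚᵘ (ℤ.+ P) Q-1
    fraction = nonNeg⇒fraction t (proj₁ (proj₁ τ≡t))

  open Fraction t (proj₁ fraction) (proj₁ (proj₂ fraction)) (proj₂ (proj₂ fraction))

  P : ℕ
  P = proj₁ fraction

  P≤Q : P ≤ Q
  P≤Q = t≤1⇒P≤Q t≤1

  Q*∣S∣≡P*c : Q * ∣ S ∣ ≡ P * c
  Q*∣S∣≡P*c = n≡t*m⇒Q*n≡P*m ∣ S ∣ c ∣S∣≡t*c

  toughness-bound : ∀ T k → NumComponents A (∁ T) k → 2 ≤ k → P * k ≤ Q * ∣ T ∣
  toughness-bound T k nc 2≤k = t*m≤n⇒P*m≤Q*n k ∣ T ∣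
    (proj₂ (proj₁ τ≡t) T k (λ _ → ∈⊤) (subst (λ W → NumComponents A W k) (sym (⊤─p≡∁p T)) nc) 2≤k)

  InComponent : Fin c → Fin n → Set
  InComponent j v = v ∈ ∁ S × label v ≡ j

  component : Fin c → Subset n
  component j = toSubset (λ v → (v ∈? ∁ S) ×-dec (label v ≟ j))

  ∈-component⁺ : ∀ {j v} → InComponent j v → v ∈ component j
  ∈-component⁺ = ∈-toSubset⁺ _

  ∈-component⁻ : ∀ {j v} → v ∈ component j → InComponent j v
  ∈-component⁻ = ∈-toSubset⁻ _

  rep∈component : ∀ j → rep j ∈ component j
  rep∈component j = ∈-component⁺ (rep∈ j , label-rep j)

  component-isComponent : ∀ j → IsComponent A (∁ S) (component j)
  component-isComponent j = (rep j , rep∈component j) , (λ v∈ → proj₁ (∈-component⁻ v∈)) ,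
    (λ u v u∈ v∈ → label≡⇒Reach (proj₁ (∈-component⁻ u∈)) (proj₁ (∈-component⁻ v∈))
                     (trans (proj₂ (∈-component⁻ u∈)) (sym (proj₂ (∈-component⁻ v∈))))) ,
    (λ u v u∈ r → ∈-component⁺ (Reach-last∈ r , trans (sym (Reach⇒label≡ r)) (proj₂ (∈-component⁻ u∈))))

  component-injective : Injective _≡_ _≡_ component
  component-injective {i} {j} eq =
    trans (sym (label-rep i)) (proj₂ (∈-component⁻ (subst (rep i ∈_) eq (rep∈component i))))

  module AdjacentComponents (S′ : Subset n) (S′⊆S : S′ ⊆ S) (s : Fin n) (s∈S′ : s ∈ S′) where

    Adjacent : Fin c → Set
    Adjacent j = ∃ λ u → u ∈ S′ × ∃ λ v → InComponent j v × A u v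

    Adjacent? : ∀ j → Dec (Adjacent j)
    Adjacent? j =
      FP.any? λ u → (u ∈? S′) ×-dec FP.any? λ v → ((v ∈? ∁ S) ×-dec (label v ≟ j)) ×-dec dec G u v

    adjacent : Subset c
    adjacent = toSubset Adjacent?

    adjacentComponents : AdjToAtLeast G S S′ ∣ adjacent ∣
    adjacentComponents =
      (λ i → component (members adjacent i)) ,
      (λ eq → members-injective adjacent (component-injective eq)) ,
      λ i → let (u , u∈ , v , v-in , uv) = ∈-toSubset⁻ Adjacent? (members-∈ adjacent i)
            in component-isComponent _ , u , v , u∈ , ∈-component⁺ v-in , uv

    X : Subset n
    X = S ─ S′

    s∈∁X : s ∈ ∁ X
    s∈∁X = x∉p⇒x∈∁p λ s∈X → proj₂ (x∈p─q⁻ s∈X) s∈S′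

    nonadjacent-closed : ∀ j → j ∉ adjacent → StepClosed (∁ X) (component j)
    nonadjacent-closed j j∉ {x} {y} x∈ y∈∁X a = ∈-component⁺ (y∈∁S ,
      trans (sym (Reach⇒label≡ (Reach-edge (proj₁ (∈-component⁻ x∈)) y∈∁S a))) (proj₂ (∈-component⁻ x∈)))
      where
      y∈S⇒y∈S′ : y ∈ S → y ∈ S′
      y∈S⇒y∈S′ y∈S = decidable-stable (y ∈? S′) λ y∉S′ → x∈∁p⇒x∉p y∈∁X (x∈p∧x∉q⇒x∈p─q y∈S y∉S′)
      y∈∁S : y ∈ ∁ S
      y∈∁S = x∉p⇒x∈∁p λ y∈S →
        j∉ (∈-toSubset⁺ Adjacent? (y , y∈S⇒y∈S′ y∈S , x , ∈-component⁻ x∈ , Graph.sym G a))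

    witness : Fin (suc ∣ ∁ adjacent ∣) → Fin n
    witness zero = s
    witness (suc i) = rep (members (∁ adjacent) i)

    witness∈ : ∀ i → witness i ∈ ∁ X
    witness∈ zero = s∈∁X
    witness∈ (suc i) = x∉p⇒x∈∁p λ x∈X → x∈∁p⇒x∉p (rep∈ _) (proj₁ (x∈p─q⁻ x∈X))

    from-nonadjacent-stays : ∀ i {v} → Reach A (∁ X) (witness (suc i)) v →
                             v ∈ component (members (∁ adjacent) i)
    from-nonadjacent-stays i r = Reach-closed _
      (nonadjacent-closed _ (x∈∁p⇒x∉p (members-∈ (∁ adjacent) i))) r (rep∈component _)

    s∉∁S : s ∉ ∁ S
    s∉∁S s∈∁S = x∈∁p⇒x∉p s∈∁S (S′⊆S s∈S′)

    witness-separated : ∀ i j → Reach A (∁ X) (witness i) (witness j) → i ≡ j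
    witness-separated zero zero r = refl
    witness-separated zero (suc j) r = ⊥-elim (s∉∁S (proj₁ (∈-component⁻ (from-nonadjacent-stays j (Reach-sym r)))))
    witness-separated (suc i) zero r = ⊥-elim (s∉∁S (proj₁ (∈-component⁻ (from-nonadjacent-stays i r))))
    witness-separated (suc i) (suc j) r = cong suc (members-injective (∁ adjacent)
      (trans (sym (proj₂ (∈-component⁻ (from-nonadjacent-stays i r)))) (label-rep _)))

    nonadjacent+1≤c[G-X] : ∀ {c′} → NumComponents A (∁ X) c′ → suc ∣ ∁ adjacent ∣ ≤ c′
    nonadjacent+1≤c[G-X] ncX = separated⇒≤ ncX witness witness-separated witness∈

    -- In G − (S ─ S′) the vertex s and the components missed by S′ stay pairwise
    -- separated; toughness then bounds ∣ S ─ S′ ∣, hence ∣ S′ ∣, from below.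
    bound-by : ∀ {c′} → NumComponents A (∁ X) c′ → Dec (2 ≤ c′) →
               Q * ∣ S′ ∣ + P ≤ P * ∣ adjacent ∣ ⊎ ∣ adjacent ∣ ≡ c
    bound-by {c′} ncX (yes 2≤c′) = inj₁ (ℕP.+-cancelʳ-≤ (P * mb) _ _ scaled)
      where
      open ℕP.≤-Reasoning
      mb : ℕ
      mb = ∣ ∁ adjacent ∣
      regroup : ∀ Q s P mb → Q * s + P + P * mb ≡ Q * s + P * suc mb
      regroup Q s P mb = trans (ℕP.+-assoc (Q * s) P (P * mb)) (cong (Q * s +_) (sym (ℕP.*-suc P mb)))
      scaled : Q * ∣ S′ ∣ + P + P * mb ≤ P * ∣ adjacent ∣ + P * mb
      scaled = begin
        Q * ∣ S′ ∣ + P + P * mb   ≡⟨ regroup Q ∣ S′ ∣ P mb ⟩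
        Q * ∣ S′ ∣ + P * suc mb   ≤⟨ ℕP.+-monoʳ-≤ (Q * ∣ S′ ∣) (ℕP.≤-trans
                                       (ℕP.*-monoʳ-≤ P (nonadjacent+1≤c[G-X] ncX)) (toughness-bound X c′ ncX 2≤c′)) ⟩
        Q * ∣ S′ ∣ + Q * ∣ X ∣    ≡⟨ sym (ℕP.*-distribˡ-+ Q ∣ S′ ∣ ∣ X ∣) ⟩
        Q * (∣ S′ ∣ + ∣ X ∣)      ≡⟨ cong (Q *_) (trans (ℕP.+-comm ∣ S′ ∣ ∣ X ∣) (∣p─q∣+∣q∣≡∣p∣ S S′ S′⊆S)) ⟩
        Q * ∣ S ∣                 ≡⟨ Q*∣S∣≡P*c ⟩
        P * c                     ≡⟨ cong (P *_) (sym (∣p∣+∣∁p∣≡n adjacent)) ⟩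
        P * (∣ adjacent ∣ + mb)   ≡⟨ ℕP.*-distribˡ-+ P ∣ adjacent ∣ mb ⟩
        P * ∣ adjacent ∣ + P * mb ∎
    bound-by ncX (no c′≱2) =
      inj₂ (trans (sym (ℕP.+-identityʳ _)) (trans (cong (λ x → ∣ adjacent ∣ + x) (sym mb≡0)) (∣p∣+∣∁p∣≡n adjacent)))
      where
      mb≡0 : ∣ ∁ adjacent ∣ ≡ 0
      mb≡0 = ℕP.n≤0⇒n≡0 (ℕP.≤-pred (ℕP.≤-trans (nonadjacent+1≤c[G-X] ncX) (ℕP.≤-pred (ℕP.≰⇒> c′≱2))))

    bound : Q * ∣ S′ ∣ + P ≤ P * ∣ adjacent ∣ ⊎ ∣ adjacent ∣ ≡ c
    bound = let (c′ , ncX) = numComponents (∁ X) (s , s∈∁X) in bound-by ncX (2 ≤? c′)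

  adjacent-components : ∀ S′ → S′ ⊆ S → Nonempty S′ →
    ∃ λ m → AdjToAtLeast G S S′ m × (Q * ∣ S′ ∣ + P ≤ P * m ⊎ m ≡ c)
  adjacent-components S′ S′⊆S (s , s∈S′) = _ , adjacentComponents , bound
    where open AdjacentComponents S′ S′⊆S s s∈S′

  adjacent-components-⊂ : ∀ S′ → Nonempty S′ → S′ ⊂ S →
    ∃[ m ] (AdjToAtLeast G S S′ m × ℕ→ℚ ∣ S′ ∣ ℚ.+ t ℚ.≤ t ℚ.* ℕ→ℚ m)
  adjacent-components-⊂ S′ ne S′⊂S =
    let (m , adj , bound) = adjacent-components S′ (p⊂q⇒p⊆q S′⊂S) ne
    in m , adj , Q*n+P≤P*m⇒n+t≤t*m ∣ S′ ∣ m ([ (λ le → le) , all ]′ bound)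
    where
    open ℕP.≤-Reasoning
    all : ∀ {m} → m ≡ c → Q * ∣ S′ ∣ + P ≤ P * m
    all refl = begin
      Q * ∣ S′ ∣ + P      ≤⟨ ℕP.+-monoʳ-≤ (Q * ∣ S′ ∣) P≤Q ⟩
      Q * ∣ S′ ∣ + Q      ≡⟨ trans (ℕP.+-comm (Q * ∣ S′ ∣) Q) (sym (ℕP.*-suc Q ∣ S′ ∣)) ⟩
      Q * suc ∣ S′ ∣      ≤⟨ ℕP.*-monoʳ-≤ Q (p⊂q⇒∣p∣<∣q∣ S′⊂S) ⟩
      Q * ∣ S ∣           ≡⟨ Q*∣S∣≡P*c ⟩
      P * c               ∎

  adjacent-components-⊆ : ∀ S′ → Nonempty S′ → S′ ⊆ S →
    ∃[ m ] (AdjToAtLeast G S S′ m × ℕ→ℚ ∣ S′ ∣ ℚ.≤ t ℚ.* ℕ→ℚ m)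
  adjacent-components-⊆ S′ ne S′⊆S =
    let (m , adj , bound) = adjacent-components S′ S′⊆S ne
    in m , adj , Q*n≤P*m⇒n≤t*m ∣ S′ ∣ m ([ ℕP.≤-trans (ℕP.m≤m+n _ P) , all ]′ bound)
    where
    all : ∀ {m} → m ≡ c → Q * ∣ S′ ∣ ≤ P * m
    all refl = ℕP.≤-trans (ℕP.*-monoʳ-≤ Q (p⊆q⇒∣p∣≤∣q∣ S′⊆S)) (ℕP.≤-reflexive Q*∣S∣≡P*c)

  adjacent-components-vertex : ∀ v → v ∈ S → AdjToAtLeast G S ⁅ v ⁆ 2
  adjacent-components-vertex v v∈S =
    let (m , adj , bound) = adjacent-components ⁅ v ⁆ ⁅v⁆⊆S (v , x∈⁅x⁆ v)
    in AdjToAtLeast-≤ G (2≤m bound) adj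
    where
    open ℕP.≤-Reasoning
    ⁅v⁆⊆S : ⁅ v ⁆ ⊆ S
    ⁅v⁆⊆S x∈ = subst (_∈ S) (sym (x∈⁅y⁆⇒x≡y v x∈)) v∈S
    2≤m : ∀ {m} → Q * ∣ ⁅ v ⁆ ∣ + P ≤ P * m ⊎ m ≡ c → 2 ≤ m
    2≤m (inj₂ refl) = s≤s (s≤s z≤n)
    2≤m {m} (inj₁ le) = ℕP.≮⇒≥ λ m<2 → ℕP.<-irrefl refl (begin-strict
      P                   <⟨ subst (λ x → P < Q * x + P) (sym (∣⁅x⁆∣≡1 v)) (ℕP.m<n+m P (s≤s z≤n)) ⟩
      Q * ∣ ⁅ v ⁆ ∣ + P   ≤⟨ le ⟩
      P * m               ≤⟨ ℕP.*-monoʳ-≤ P (ℕP.≤-pred m<2) ⟩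
      P * 1               ≡⟨ ℕP.*-identityʳ P ⟩
      P                   ∎)

  module ComponentOutsideS {R : Subset n} (R-component : IsComponent A (∁ S) R) where

    R⊆∁S : R ⊆ ∁ S
    R⊆∁S = proj₁ (proj₂ R-component)

    R-connected : ∀ u v → u ∈ R → v ∈ R → Reach A (∁ S) u v
    R-connected = proj₁ (proj₂ (proj₂ R-component))

    R-stepClosed : StepClosed (∁ S) R
    R-stepClosed {x} {y} x∈R y∈∁S a =
      proj₂ (proj₂ (proj₂ R-component)) x y x∈R (Reach-edge (R⊆∁S x∈R) y∈∁S a)

    ∉R-adjacent-R⇒∈S : ∀ {v a} → v ∉ R → a ∈ R → A v a → v ∈ S
    ∉R-adjacent-R⇒∈S v∉R a∈R va = decidable-stable (_ ∈? S) λ v∉S →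
      v∉R (R-stepClosed a∈R (x∉p⇒x∈∁p v∉S) (Graph.sym G va))

    component≢R⇒neighbour-outside-R : ∀ {v R′} → IsComponent A (∁ S) R′ → AdjSets A ⁅ v ⁆ R′ → R′ ≢ R →
                                      ∃ λ y → y ∈ ∁ S × y ∉ R × A v y
    component≢R⇒neighbour-outside-R R′-component (u , y , u∈⁅v⁆ , y∈R′ , uy) R′≢R =
      y , proj₁ (proj₂ R′-component) y∈R′ ,
      (λ y∈R → R′≢R (IsComponent-unique R′-component R-component y∈R′ y∈R)) ,
      subst (λ z → A z y) (x∈⁅y⁆⇒x≡y _ u∈⁅v⁆) uy

    -- v sees two components of G − S, and they are not both R
    neighbour-outside-R : ∀ {v} → v ∈ S → ∃ λ y → y ∈ ∁ S × y ∉ R × A v y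
    neighbour-outside-R {v} v∈S = two-components (adjacent-components-vertex v v∈S)
      where
      two-components : AdjToAtLeast G S ⁅ v ⁆ 2 → ∃ λ y → y ∈ ∁ S × y ∉ R × A v y
      two-components (Rs , Rs-inj , Rs-ok) =
        [ (λ Rs₀≡R → via (suc zero) λ Rs₁≡R → FP.0≢1+n (Rs-inj (trans Rs₀≡R (sym Rs₁≡R)))) , via zero ]′
        (toSum (VP.≡-dec Bool._≟_ (Rs zero) R))
        where
        via : ∀ j → Rs j ≢ R → ∃ λ y → y ∈ ∁ S × y ∉ R × A v y
        via j = component≢R⇒neighbour-outside-R (proj₁ (Rs-ok j)) (proj₂ (Rs-ok j))

  module MaximalToughSetComponent (maximal : MaximalToughSet G S) (k : ℕ)
    (1/k≤t : (ℤ.+ 1 / suc k) ℚ.≤ t) (R : Subset n) (R-component : IsComponent A (∁ S) R) where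

    open ComponentOutsideS R-component

    r₀ : Fin n
    r₀ = proj₁ (proj₁ R-component)

    label-R : ∀ {v} → v ∈ R → label v ≡ label r₀
    label-R v∈R = sym (Reach⇒label≡ (R-connected _ _ (proj₂ (proj₁ R-component)) v∈R))

    module Cut (T : Subset n) (cR : ℕ) (T⊆R : T ⊆ R) (ncR : NumComponents A (R ─ T) cR)
               (2≤cR : 2 ≤ cR) where
      module RT = Components ncR

      Y : Subset n
      Y = S ∪ T

      ∈∁Y⁺ : ∀ {x} → x ∉ S → x ∉ T → x ∈ ∁ Y
      ∈∁Y⁺ x∉S x∉T = x∉p⇒x∈∁p λ x∈Y → [ x∉S , x∉T ]′ (x∈p∪q⁻ S T x∈Y)

      ∁Y⊆∁S : ∁ Y ⊆ ∁ S
      ∁Y⊆∁S x∈∁Y = x∉p⇒x∈∁p λ x∈S → x∈∁p⇒x∉p x∈∁Y (x∈p∪q⁺ (inj₁ x∈S))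

      inner : Fin cR → Fin n
      inner = RT.rep

      outer : Fin (suc c₁) → Fin n
      outer i = rep (punchIn (label r₀) i)

      outer∉R : ∀ i → outer i ∉ R
      outer∉R i v∈R = FP.punchInᵢ≢i (label r₀) i (trans (sym (label-rep _)) (label-R v∈R))

      inner∈∁Y : ∀ i → inner i ∈ ∁ Y
      inner∈∁Y i = ∈∁Y⁺ (x∈∁p⇒x∉p (R⊆∁S (proj₁ (x∈p─q⁻ (RT.rep∈ i))))) (proj₂ (x∈p─q⁻ (RT.rep∈ i)))

      outer∈∁Y : ∀ i → outer i ∈ ∁ Y
      outer∈∁Y i = ∈∁Y⁺ (x∈∁p⇒x∉p (rep∈ _)) (λ v∈T → outer∉R i (T⊆R v∈T))

      R─T-stepClosed : StepClosed (∁ Y) (R ─ T)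
      R─T-stepClosed x∈ y∈∁Y a =
        x∈p∧x∉q⇒x∈p─q (R-stepClosed (proj₁ (x∈p─q⁻ x∈)) (∁Y⊆∁S y∈∁Y) a)
                      (λ y∈T → x∈∁p⇒x∉p y∈∁Y (x∈p∪q⁺ (inj₂ y∈T)))

      cR+c-1≤c[G-Y] : ∀ {cY} (ncY : NumComponents A (∁ Y) cY) → cR + suc c₁ ≤ cY
      cR+c-1≤c[G-Y] ncY = separated₂⇒+≤ ncY inner outer
        (λ i j r → RT.Reach-rep⇒≡ (Reach-restrict (R ─ T) R─T-stepClosed r (RT.rep∈ i)))
        (λ i j r → FP.punchIn-injective (label r₀) i j (Reach-rep⇒≡ (Reach-mono ∁Y⊆∁S r)))
        (λ i j r → FP.punchInᵢ≢i (label r₀) j (trans (sym (label-rep _))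
          (trans (sym (Reach⇒label≡ (Reach-mono ∁Y⊆∁S r))) (label-R (proj₁ (x∈p─q⁻ (RT.rep∈ i)))))))
        inner∈∁Y outer∈∁Y

      T-nonempty : Nonempty T
      T-nonempty = decidable-stable (nonempty? T) λ T-empty →
        ℕP.<-irrefl refl (ℕP.≤-trans 2≤cR (connected⇒≤1 ncR λ u v u∈ v∈ →
          Reach-mono (λ x∈R → x∈p∧x∉q⇒x∈p─q x∈R (λ x∈T → T-empty (_ , x∈T)))
            (Reach-restrict R R-stepClosed (R-connected u v (proj₁ (x∈p─q⁻ u∈)) (proj₁ (x∈p─q⁻ v∈)))
                            (proj₁ (x∈p─q⁻ u∈)))))

      -- S ∪ T is not a tough-set, as it properly extends the maximal tough-set S
      P*c[G-Y]<Q*∣Y∣ : ∀ {cY} → NumComponents A (∁ Y) cY → 2 ≤ cY → P * cY < Q * ∣ Y ∣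
      P*c[G-Y]<Q*∣Y∣ ncY 2≤cY = ℕP.≤∧≢⇒< (toughness-bound Y _ ncY 2≤cY) λ eq →
        let (x , x∈T) = T-nonempty
            Y-toughSet : ToughSet G Y
            Y-toughSet = t , τ≡t , _ , ncY , 2≤cY , Q*n≡P*m⇒n≡t*m ∣ Y ∣ _ (sym eq)
        in x∈∁p⇒x∉p (R⊆∁S (T⊆R x∈T))
             (proj₂ maximal Y Y-toughSet (λ x∈S → x∈p∪q⁺ (inj₁ x∈S)) (x∈p∪q⁺ (inj₂ x∈T)))

      c[G-Y]⇒cR≤∣T∣*k : ∀ {cY} → NumComponents A (∁ Y) cY → cR ≤ ∣ T ∣ * suc k
      c[G-Y]⇒cR≤∣T∣*k {cY} ncY =
        ℕP.≤-pred (ℕP.*-cancelˡ-< P cR _ (ℕP.+-cancelʳ-< (P * suc c₁) (P * cR) _ (begin-strict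
        P * cR + P * suc c₁           ≡⟨ sym (ℕP.*-distribˡ-+ P cR (suc c₁)) ⟩
        P * (cR + suc c₁)             ≤⟨ ℕP.*-monoʳ-≤ P (cR+c-1≤c[G-Y] ncY) ⟩
        P * cY                        <⟨ P*c[G-Y]<Q*∣Y∣ ncY 2≤cY ⟩
        Q * ∣ Y ∣                     ≡⟨ cong (Q *_) (disjoint⇒∣p∪q∣≡∣p∣+∣q∣ S T x∈S⇒x∉T) ⟩
        Q * (∣ S ∣ + ∣ T ∣)           ≡⟨ ℕP.*-distribˡ-+ Q ∣ S ∣ ∣ T ∣ ⟩
        Q * ∣ S ∣ + Q * ∣ T ∣         ≡⟨ cong (_+ Q * ∣ T ∣) Q*∣S∣≡P*c ⟩
        P * c + Q * ∣ T ∣             ≤⟨ ℕP.+-monoʳ-≤ (P * c) (ℕP.*-monoˡ-≤ ∣ T ∣ (1/k≤t⇒Q≤P*k k 1/k≤t)) ⟩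
        P * c + P * suc k * ∣ T ∣     ≡⟨ regroup P c₁ k ∣ T ∣ ⟩
        P * suc (∣ T ∣ * suc k) + P * suc c₁ ∎)))
        where
        open ℕP.≤-Reasoning
        2≤cY : 2 ≤ cY
        2≤cY = ℕP.≤-trans 2≤cR (ℕP.≤-trans (ℕP.m≤m+n cR _) (cR+c-1≤c[G-Y] ncY))
        x∈S⇒x∉T : ∀ {x} → x ∈ S → x ∉ T
        x∈S⇒x∉T x∈S x∈T = x∈∁p⇒x∉p (R⊆∁S (T⊆R x∈T)) x∈S
        regroup : ∀ P c₁ k T → P * (2 + c₁) + P * (1 + k) * T ≡ P * (1 + T * (1 + k)) + P * (1 + c₁)
        regroup = solve-∀

      cR≤∣T∣*k : cR ≤ ∣ T ∣ * suc k
      cR≤∣T∣*k = let (_ , ncY) = numComponents (∁ Y) (outer zero , outer∈∁Y zero) in c[G-Y]⇒cR≤∣T∣*k ncY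

  maximal⇒component-tough : MaximalToughSet G S → (k : ℕ) .{{_ : NonZero k}} →
    (ℤ.+ 1 / k) ℚ.≤ t → ∀ R → IsComponent A (∁ S) R → ToughOn A R (ℤ.+ 1 / k)
  maximal⇒component-tough maximal (suc k) 1/k≤t R R-component = 0≤1/k k , λ T cR T⊆R ncR 2≤cR →
    m≤n*k⇒1/k*m≤n k cR ∣ T ∣ (Cut.cR≤∣T∣*k T cR T⊆R ncR 2≤cR)
    where open MaximalToughSetComponent maximal k 1/k≤t R R-component

  module Contraction (P₄-free : ¬ HasInducedP4 G) (R : Subset n) (R-component : IsComponent A (∁ S) R)
                     (r : Fin n) (r∈R : r ∈ R) where

    B : Fin n → Fin n → Set
    B = ContractAdj G R r

    W′ : Subset n
    W′ = ∁ R ∪ ⁅ r ⁆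

    open ComponentOutsideS R-component

    ∈W′⁻ : ∀ {x} → x ∈ W′ → x ∉ R ⊎ x ≡ r
    ∈W′⁻ x∈ = [ (λ x∈∁R → inj₁ (x∈∁p⇒x∉p x∈∁R)) , (λ x∈⁅r⁆ → inj₂ (x∈⁅y⁆⇒x≡y r x∈⁅r⁆)) ]′
              (x∈p∪q⁻ (∁ R) ⁅ r ⁆ x∈)

    ∈W′⁺ : ∀ {x} → x ∉ R → x ∈ W′
    ∈W′⁺ x∉R = x∈p∪q⁺ (inj₁ (x∉p⇒x∈∁p x∉R))

    r∈W′ : r ∈ W′
    r∈W′ = x∈p∪q⁺ (inj₂ (x∈⁅x⁆ r))

    -- along a walk a, a′, … in R: for y a neighbour of v outside R, y v a a′ would be an induced P₄
    adjacent-R⇒complete-to-R : ∀ {v a b} → v ∈ S → a ∈ R → A v a → b ∈ R → A v b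
    adjacent-R⇒complete-to-R {v} {a} {b} v∈S a∈R va b∈R =
      along (neighbour-outside-R v∈S) (Reach-restrict R R-stepClosed (R-connected a b a∈R b∈R) a∈R) va
      where
      along : (∃ λ y → y ∈ ∁ S × y ∉ R × A v y) → ∀ {a b} → Reach A R a b → A v a → A v b
      along _ (here _) va = va
      along nb@(y , y∈∁S , y∉R , vy) (step {u = a} {v = a′} a∈R aa′ rest) va =
        along nb rest (decidable-stable (dec G v a′) λ ¬va′ → P₄-free (y , v , a , a′ ,
          x∉p∧y∈p⇒x≢y (x∈∁p⇒x∉p y∈∁S) v∈S , x∉p∧y∈p⇒x≢y y∉R a∈R , x∉p∧y∈p⇒x≢y y∉R a′∈R ,
          x∈p∧y∉p⇒x≢y v∈S (x∈∁p⇒x∉p (R⊆∁S a∈R)) , x∈p∧y∉p⇒x≢y v∈S (x∈∁p⇒x∉p (R⊆∁S a′∈R)) ,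
          (λ { refl → Graph.irrefl G aa′ }) ,
          Graph.sym G vy , va , aa′ , y≁R a∈R , ¬va′ , y≁R a′∈R))
        where
        a′∈R : a′ ∈ R
        a′∈R = Reach-head∈ rest
        y≁R : ∀ {a} → a ∈ R → ¬ A y a
        y≁R a∈R ya = y∉R (R-stepClosed a∈R y∈∁S (Graph.sym G ya))

    module WithoutR (T : Subset n) (c′ : ℕ) (T⊆W′ : T ⊆ W′) (nc′ : NumComponents B (W′ ─ T) c′)
                    (r∉T : r ∉ T) where
      module C′ = Components nc′

      D : Subset n
      D = W′ ─ T

      collapse-by : (u : Fin n) → Dec (u ∈ R) → Fin n
      collapse-by u (yes _) = r
      collapse-by u (no _) = u

      collapse : Fin n → Fin n
      collapse u = collapse-by u (u ∈? R)

      collapse-by-∈ : ∀ {u} → u ∈ ∁ T → (u∈R? : Dec (u ∈ R)) → collapse-by u u∈R? ∈ D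
      collapse-by-∈ u∈∁T (yes _) = x∈p∧x∉q⇒x∈p─q r∈W′ r∉T
      collapse-by-∈ u∈∁T (no u∉R) = x∈p∧x∉q⇒x∈p─q (∈W′⁺ u∉R) (x∈∁p⇒x∉p u∈∁T)

      collapse-by-edge : ∀ {u w} → A u w → (u∈R? : Dec (u ∈ R)) (w∈R? : Dec (w ∈ R)) →
        collapse-by u u∈R? ≡ collapse-by w w∈R? ⊎ B (collapse-by u u∈R?) (collapse-by w w∈R?)
      collapse-by-edge a (yes _) (yes _) = inj₁ refl
      collapse-by-edge a (no u∉R) (no w∉R) = inj₂ (inj₁ (u∉R , w∉R , a))
      collapse-by-edge {u} {w} a (no u∉R) (yes w∈R) = inj₂ (inj₂ (inj₂ (refl , u∉R , w , w∈R , a)))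
      collapse-by-edge {u} {w} a (yes u∈R) (no w∉R) = inj₂ (inj₂ (inj₁ (refl , w∉R , u , u∈R , a)))

      collapse-Reach : ∀ {u v} → Reach A (∁ T) u v → Reach B D (collapse u) (collapse v)
      collapse-Reach (here u∈) = here (collapse-by-∈ u∈ (_ ∈? R))
      collapse-Reach (step {u} {w} u∈ a r) =
        [ (λ eq → subst (λ z → Reach B D z _) (sym eq) (collapse-Reach r)) ,
          (λ b → step (collapse-by-∈ u∈ (u ∈? R)) b (collapse-Reach r)) ]′
        (collapse-by-edge a (u ∈? R) (w ∈? R))

      collapse-by-fixes-W′ : ∀ {u} → u ∈ W′ → (u∈R? : Dec (u ∈ R)) → collapse-by u u∈R? ≡ u
      collapse-by-fixes-W′ u∈W′ (yes u∈R) = [ (λ u∉R → ⊥-elim (u∉R u∈R)) , sym ]′ (∈W′⁻ u∈W′)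
      collapse-by-fixes-W′ u∈W′ (no _) = refl

      collapse-fixes-W′ : ∀ {u} → u ∈ W′ → collapse u ≡ u
      collapse-fixes-W′ {u} u∈W′ = collapse-by-fixes-W′ u∈W′ (u ∈? R)

      separated : ∀ i j → Reach A (∁ T) (C′.rep i) (C′.rep j) → i ≡ j
      separated i j r′ = C′.Reach-rep⇒≡ (subst₂ (Reach B D)
        (collapse-fixes-W′ (proj₁ (x∈p─q⁻ (C′.rep∈ i)))) (collapse-fixes-W′ (proj₁ (x∈p─q⁻ (C′.rep∈ j))))
        (collapse-Reach r′))

      c′≤c[G-T] : ∀ {cT} → NumComponents A (∁ T) cT → c′ ≤ cT
      c′≤c[G-T] ncT = separated⇒≤ ncT C′.rep separated λ i → x∉p⇒x∈∁p (proj₂ (x∈p─q⁻ (C′.rep∈ i)))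

      bound : 2 ≤ c′ → P * c′ ≤ Q * ∣ T ∣
      bound 2≤c′ =
        let (cT , ncT) = numComponents (∁ T) (r , x∉p⇒x∈∁p r∉T)
        in ℕP.≤-trans (ℕP.*-monoʳ-≤ P (c′≤c[G-T] ncT)) (toughness-bound T cT ncT (ℕP.≤-trans 2≤c′ (c′≤c[G-T] ncT)))

    module WithR (T : Subset n) (c′ : ℕ) (T⊆W′ : T ⊆ W′) (nc′ : NumComponents B (W′ ─ T) c′)
                 (2≤c′ : 2 ≤ c′) (r∈T : r ∈ T) where

      D : Subset n
      D = W′ ─ T

      T₀ : Subset n
      T₀ = T - r

      ∈D⁻ : ∀ {x} → x ∈ D → x ∉ R × x ∉ T
      ∈D⁻ x∈D = let (x∈W′ , x∉T) = x∈p─q⁻ x∈D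
                in [ (λ x∉R → x∉R) , (λ { refl → ⊥-elim (x∉T r∈T) }) ]′ (∈W′⁻ x∈W′) , x∉T

      ∈D⁺ : ∀ {x} → x ∉ R → x ∉ T → x ∈ D
      ∈D⁺ x∉R x∉T = x∈p∧x∉q⇒x∈p─q (∈W′⁺ x∉R) x∉T

      ∈T₀⁻ : ∀ {x} → x ∈ T₀ → x ∈ T × x ∉ R
      ∈T₀⁻ x∈T₀ = let (x∈T , x∉⁅r⁆) = x∈p─q⁻ x∈T₀
                  in x∈T , [ (λ x∉R → x∉R) , (λ { refl → ⊥-elim (x∉⁅r⁆ (x∈⁅x⁆ r)) }) ]′ (∈W′⁻ (T⊆W′ x∈T))

      ∉R∧∉D⇒∈T₀ : ∀ {y} → y ∉ R → y ∉ D → y ∈ T₀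
      ∉R∧∉D⇒∈T₀ {y} y∉R y∉D = x∈p∧x≢y⇒x∈p-y (decidable-stable (y ∈? T) λ y∉T → y∉D (∈D⁺ y∉R y∉T))
                                             (λ { refl → y∉R r∈R })

      r∉T₀ : r ∉ T₀
      r∉T₀ r∈T₀ = proj₂ (∈T₀⁻ r∈T₀) r∈R

      ∣T₀∣≤∣T∣ : ∣ T₀ ∣ ≤ ∣ T ∣
      ∣T₀∣≤∣T∣ = ∣p─q∣≤∣p∣ T ⁅ r ⁆

      ∣T₀∣+1≡∣T∣ : ∣ T₀ ∣ + 1 ≡ ∣ T ∣
      ∣T₀∣+1≡∣T∣ = trans (cong (λ x → ∣ T₀ ∣ + x) (sym (∣⁅x⁆∣≡1 r)))
                        (∣p─q∣+∣q∣≡∣p∣ T ⁅ r ⁆ λ x∈⁅r⁆ → subst (_∈ T) (sym (x∈⁅y⁆⇒x≡y r x∈⁅r⁆)) r∈T)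

      -- r ∈ T, so G′ − T is the induced subgraph G[D]
      ncD : NumComponents A D c′
      ncD = proj₁ nc′ , proj₁ (proj₂ nc′) , λ u v u∈ v∈ →
        mk⇔ (λ eq → Walk.Reach-map B A B⇒A (Equivalence.to (proj₂ (proj₂ nc′) u v u∈ v∈) eq))
            (λ r′ → Equivalence.from (proj₂ (proj₂ nc′) u v u∈ v∈) (Reach-map B A⇒B r′))
        where
        B⇒A : ∀ {x y} → x ∈ D → y ∈ D → B x y → A x y
        B⇒A _ _ (inj₁ (_ , _ , a)) = a
        B⇒A x∈D _ (inj₂ (inj₁ (refl , _))) = ⊥-elim (proj₁ (∈D⁻ x∈D) r∈R)
        B⇒A _ y∈D (inj₂ (inj₂ (refl , _))) = ⊥-elim (proj₁ (∈D⁻ y∈D) r∈R)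
        A⇒B : ∀ {x y} → x ∈ D → y ∈ D → A x y → B x y
        A⇒B x∈D y∈D a = inj₁ (proj₁ (∈D⁻ x∈D) , proj₁ (∈D⁻ y∈D) , a)

      module CD = Components ncD

      label-edge : ∀ {u w} → u ∈ D → w ∈ D → A u w → CD.label u ≡ CD.label w
      label-edge u∈D w∈D a = CD.Reach⇒label≡ (Reach-edge u∈D w∈D a)

      Touching : Fin c′ → Set
      Touching ℓ = ∃ λ v → (v ∈ D × CD.label v ≡ ℓ) × ∃ λ a → a ∈ R × A v a

      Touching? : ∀ ℓ → Dec (Touching ℓ)
      Touching? ℓ = FP.any? λ v → ((v ∈? D) ×-dec (CD.label v ≟ ℓ)) ×-dec FP.any? λ a → (a ∈? R) ×-dec dec G v a

      TwoTouching : Set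
      TwoTouching = ∃ λ i → ∃ λ j → i ≢ j × Touching i × Touching j

      twoTouching? : Dec TwoTouching
      twoTouching? = FP.any? λ i → FP.any? λ j → ¬? (i ≟ j) ×-dec Touching? i ×-dec Touching? j

      module AtMostOneTouching (¬two : ¬ TwoTouching) where

        -- a walk of G − T₀ leaving D steps into R, so the component it leaves touches R
        leave⇒touching : ∀ i j → Reach A (∁ T₀) (CD.rep i) (CD.rep j) → i ≡ j ⊎ Touching i
        leave⇒touching i j r′ = [ (λ r-in-D → inj₁ (CD.Reach-rep⇒≡ r-in-D)) , inj₂ ∘ exit-touches ]′
                                  (Reach-exit D r′ (CD.rep∈ i))
          where
          exit-touches : (∃[ x ] ∃[ y ] (Reach A D (CD.rep i) x × A x y × y ∈ ∁ T₀ × y ∉ D)) → Touching i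
          exit-touches (x , y , r-to-x , xy , y∈∁T₀ , y∉D) =
            x , (Reach-last∈ r-to-x , trans (sym (CD.Reach⇒label≡ r-to-x)) (CD.label-rep i)) ,
            y , decidable-stable (y ∈? R) (λ y∉R → x∈∁p⇒x∉p y∈∁T₀ (∉R∧∉D⇒∈T₀ y∉R y∉D)) , xy

        separated : ∀ i j → Reach A (∁ T₀) (CD.rep i) (CD.rep j) → i ≡ j
        separated i j r′ = decidable-stable (i ≟ j) λ i≢j →
          [ i≢j , (λ touch-i → [ (λ j≡i → i≢j (sym j≡i)) , (λ touch-j → ¬two (i , j , i≢j , touch-i , touch-j)) ]′
                                (leave⇒touching j i (Reach-sym r′))) ]′
          (leave⇒touching i j r′)

        c′≤c[G-T₀] : ∀ {cT₀} → NumComponents A (∁ T₀) cT₀ → c′ ≤ cT₀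
        c′≤c[G-T₀] ncT₀ = separated⇒≤ ncT₀ CD.rep separated λ i →
          x∉p⇒x∈∁p λ x∈T₀ → proj₂ (∈D⁻ (CD.rep∈ i)) (proj₁ (∈T₀⁻ x∈T₀))

        bound : P * c′ ≤ Q * ∣ T ∣
        bound =
          let (cT₀ , ncT₀) = numComponents (∁ T₀) (r , x∉p⇒x∈∁p r∉T₀)
          in ℕP.≤-trans (ℕP.*-monoʳ-≤ P (c′≤c[G-T₀] ncT₀))
               (ℕP.≤-trans (toughness-bound T₀ cT₀ ncT₀ (ℕP.≤-trans 2≤c′ (c′≤c[G-T₀] ncT₀)))
                           (ℕP.*-monoʳ-≤ Q ∣T₀∣≤∣T∣))

      -- Let K be the union of the components of G[D] touching R. Every vertex of K is adjacent
      -- to R, so K ⊆ S and (ii) yields cK components of G − S adjacent to K with ∣ K ∣ ≤ t · cK.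
      -- Those other than R meet Y, the vertices of T₀ ∖ S adjacent to K, so cK ≤ ∣ Y ∣ + 1.
      -- Removing Z = (T₀ ─ Y) ∪ K separates the untouched components of G[D] and these cK
      -- components; toughness for Z then accounts for the untouched ones, K for the touching ones.
      module TwoTouchingComponents (i₁ i₂ : Fin c′) (i₁≢i₂ : i₁ ≢ i₂)
                                   (touch₁ : Touching i₁) (touch₂ : Touching i₂) where

        AdjacentR : Fin n → Set
        AdjacentR v = ∃ λ b → b ∈ R × A v b

        AdjacentR? : ∀ v → Dec (AdjacentR v)
        AdjacentR? v = FP.any? λ b → (b ∈? R) ×-dec dec G v b

        other-touching : ∀ ℓ → ∃ λ ℓ′ → ℓ′ ≢ ℓ × Touching ℓ′
        other-touching ℓ = [ (λ { refl → i₂ , (λ i₂≡i₁ → i₁≢i₂ (sym i₂≡i₁)) , touch₂ }) ,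
                             (λ ℓ≢i₁ → i₁ , (λ i₁≡ℓ → ℓ≢i₁ (sym i₁≡ℓ)) , touch₁) ]′ (toSum (ℓ ≟ i₁))

        K : Subset n
        K = toSubset λ v → (v ∈? D) ×-dec Touching? (CD.label v)

        ∈K⁺ : ∀ {v} → v ∈ D → Touching (CD.label v) → v ∈ K
        ∈K⁺ v∈D touch = ∈-toSubset⁺ _ (v∈D , touch)

        ∈K⁻ : ∀ {v} → v ∈ K → v ∈ D × Touching (CD.label v)
        ∈K⁻ = ∈-toSubset⁻ _

        K⊆D : K ⊆ D
        K⊆D v∈K = proj₁ (∈K⁻ v∈K)

        -- along a walk u w … of G[D] inside a touching component ℓ: for x′ adjacent to a′ ∈ R in
        -- another touching component, w u a′ x′ would be an induced P₄ unless w is adjacent to R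
        K-adjacent-R : ∀ {v} → v ∈ K → AdjacentR v
        K-adjacent-R {v} v∈K = in-touching (∈K⁻ v∈K) (other-touching (CD.label v))
          where
          ℓ : Fin c′
          ℓ = CD.label v
          in-touching : v ∈ D × Touching ℓ → (∃ λ ℓ′ → ℓ′ ≢ ℓ × Touching ℓ′) → AdjacentR v
          in-touching (v∈D , (x , (x∈D , lx) , a , a∈R , xa)) (ℓ′ , ℓ′≢ℓ , (x′ , (x′∈D , lx′) , a′ , a′∈R , x′a′)) =
            along (CD.label≡⇒Reach x∈D v∈D lx) lx (a , a∈R , xa)
            where
            ≢x′ : ∀ {z} → CD.label z ≡ ℓ → z ≢ x′
            ≢x′ lz refl = ℓ′≢ℓ (trans (sym lx′) lz)
            ≁x′ : ∀ {z} → z ∈ D → CD.label z ≡ ℓ → ¬ A z x′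
            ≁x′ z∈D lz zx′ = ℓ′≢ℓ (trans (sym lx′) (trans (sym (label-edge z∈D x′∈D zx′)) lz))
            along : ∀ {u w} → Reach A D u w → CD.label u ≡ ℓ → AdjacentR u → AdjacentR w
            along (here _) _ adj = adj
            along {u} (step {v = w} u∈D uw rest) lu (b , b∈R , ub) =
              along rest lw (decidable-stable (AdjacentR? w) λ ¬adj-w → P₄-free (w , u , a′ , x′ ,
                (λ { refl → Graph.irrefl G uw }) , x∉p∧y∈p⇒x≢y (proj₁ (∈D⁻ w∈D)) a′∈R , ≢x′ lw ,
                x∉p∧y∈p⇒x≢y (proj₁ (∈D⁻ u∈D)) a′∈R , ≢x′ lu , x∈p∧y∉p⇒x≢y a′∈R (proj₁ (∈D⁻ x′∈D)) ,
                Graph.sym G uw ,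
                adjacent-R⇒complete-to-R (∉R-adjacent-R⇒∈S (proj₁ (∈D⁻ u∈D)) b∈R ub) b∈R ub a′∈R ,
                Graph.sym G x′a′ ,
                (λ wa′ → ¬adj-w (a′ , a′∈R , wa′)) , ≁x′ u∈D lu , ≁x′ w∈D lw))
              where
              w∈D : w ∈ D
              w∈D = Reach-head∈ rest
              lw : CD.label w ≡ ℓ
              lw = trans (sym (label-edge u∈D w∈D uw)) lu

        K⊆S : K ⊆ S
        K⊆S v∈K = let (b , b∈R , vb) = K-adjacent-R v∈K in ∉R-adjacent-R⇒∈S (proj₁ (∈D⁻ (K⊆D v∈K))) b∈R vb

        touching-vertex : ∀ {ℓ} → Touching ℓ → ∃ λ x → x ∈ K × CD.label x ≡ ℓ
        touching-vertex touch@(x , (x∈D , lx) , _) = x , ∈K⁺ x∈D (subst Touching (sym lx) touch) , lx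

        InY : Fin n → Set
        InY y = y ∈ T₀ × y ∉ S × ∃ λ x → x ∈ K × A y x

        Y : Subset n
        Y = toSubset λ y → (y ∈? T₀) ×-dec ¬? (y ∈? S) ×-dec FP.any? λ x → (x ∈? K) ×-dec dec G y x

        ∈Y⁻ : ∀ {y} → y ∈ Y → InY y
        ∈Y⁻ = ∈-toSubset⁻ _

        ∈Y⁺ : ∀ {y} → InY y → y ∈ Y
        ∈Y⁺ = ∈-toSubset⁺ _

        Y⊆T₀ : Y ⊆ T₀
        Y⊆T₀ y∈Y = proj₁ (∈Y⁻ y∈Y)

        -- u y x a would be an induced P₄, for y ∈ Y adjacent to x ∈ K adjacent to a ∈ R
        D─K≁Y : ∀ {u y} → u ∈ D → u ∉ K → y ∈ Y → ¬ A u y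
        D─K≁Y {u} {y} u∈D u∉K y∈Y uy =
          let (y∈T₀ , y∉S , x , x∈K , yx) = ∈Y⁻ y∈Y
              (a , a∈R , xa) = K-adjacent-R x∈K
          in P₄-free (u , y , x , a ,
               x∉p∧y∈p⇒x≢y (proj₂ (∈D⁻ u∈D)) (proj₁ (∈T₀⁻ y∈T₀)) , x∉p∧y∈p⇒x≢y u∉K x∈K ,
               x∉p∧y∈p⇒x≢y (proj₁ (∈D⁻ u∈D)) a∈R ,
               x∈p∧y∉p⇒x≢y (proj₁ (∈T₀⁻ y∈T₀)) (proj₂ (∈D⁻ (K⊆D x∈K))) ,
               x∉p∧y∈p⇒x≢y (proj₂ (∈T₀⁻ y∈T₀)) a∈R , x∉p∧y∈p⇒x≢y (proj₁ (∈D⁻ (K⊆D x∈K))) a∈R ,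
               uy , yx , xa ,
               (λ ux → u∉K (∈K⁺ u∈D (subst Touching (sym (label-edge u∈D (K⊆D x∈K) ux)) (proj₂ (∈K⁻ x∈K))))) ,
               (λ ya → y∉S (∉R-adjacent-R⇒∈S (proj₂ (∈T₀⁻ y∈T₀)) a∈R ya)) ,
               (λ ua → u∉K (∈K⁺ u∈D (u , (u∈D , refl) , a , a∈R , ua))))

        K-components : ∃[ m ] (AdjToAtLeast G S K m × ℕ→ℚ ∣ K ∣ ℚ.≤ t ℚ.* ℕ→ℚ m)
        K-components = adjacent-components-⊆ K (_ , proj₁ (proj₂ (touching-vertex touch₁))) K⊆S

        cK : ℕ
        cK = proj₁ K-components

        Rs : Fin cK → Subset n
        Rs = proj₁ (proj₁ (proj₂ K-components))

        Rs-injective : Injective _≡_ _≡_ Rs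
        Rs-injective = proj₁ (proj₂ (proj₁ (proj₂ K-components)))

        Rs-component : ∀ j → IsComponent A (∁ S) (Rs j)
        Rs-component j = proj₁ (proj₂ (proj₂ (proj₁ (proj₂ K-components))) j)

        Rs-adjacent : ∀ j → AdjSets A K (Rs j)
        Rs-adjacent j = proj₂ (proj₂ (proj₂ (proj₁ (proj₂ K-components))) j)

        Q*∣K∣≤P*cK : Q * ∣ K ∣ ≤ P * cK
        Q*∣K∣≤P*cK = n≤t*m⇒Q*n≤P*m ∣ K ∣ cK (proj₂ (proj₂ K-components))

        Witness : Fin cK → Fin n → Set
        Witness j y = (Rs j ≡ R × y ≡ r) ⊎ (Rs j ≢ R × y ∈ Y × y ∈ Rs j × y ∉ R × y ∉ D)

        witness-by : ∀ j → Dec (Rs j ≡ R) → ∃ (Witness j)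
        witness-by j (yes Rsⱼ≡R) = r , inj₁ (Rsⱼ≡R , refl)
        witness-by j (no Rsⱼ≢R) = outside-R (Rs-adjacent j)
          where
          outside-R : AdjSets A K (Rs j) → ∃ (Witness j)
          outside-R (u , y , u∈K , y∈Rsⱼ , uy) =
            y , inj₂ (Rsⱼ≢R , ∈Y⁺ (∉R∧∉D⇒∈T₀ y∉R y∉D , x∈∁p⇒x∉p y∈∁S , u , u∈K , Graph.sym G uy) ,
                      y∈Rsⱼ , y∉R , y∉D)
            where
            y∈∁S : y ∈ ∁ S
            y∈∁S = proj₁ (proj₂ (Rs-component j)) y∈Rsⱼ
            y∉R : y ∉ R
            y∉R y∈R = Rsⱼ≢R (IsComponent-unique (Rs-component j) R-component y∈Rsⱼ y∈R)
            y∉D : y ∉ D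
            y∉D y∈D = x∈∁p⇒x∉p y∈∁S (K⊆S (∈K⁺ y∈D
              (subst Touching (label-edge (K⊆D u∈K) y∈D uy) (proj₂ (∈K⁻ u∈K)))))

        witness : Fin cK → Fin n
        witness j = proj₁ (witness-by j (VP.≡-dec Bool._≟_ (Rs j) R))

        witness-ok : ∀ j → Witness j (witness j)
        witness-ok j = proj₂ (witness-by j (VP.≡-dec Bool._≟_ (Rs j) R))

        witness-injective : Injective _≡_ _≡_ witness
        witness-injective {j} {j′} = injective (witness-ok j) (witness-ok j′)
          where
          injective : ∀ {j j′} → Witness j (witness j) → Witness j′ (witness j′) →
                      witness j ≡ witness j′ → j ≡ j′
          injective (inj₁ (Rsⱼ≡R , _)) (inj₁ (Rsⱼ′≡R , _)) _ = Rs-injective (trans Rsⱼ≡R (sym Rsⱼ′≡R))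
          injective (inj₁ (_ , wⱼ≡r)) (inj₂ (_ , _ , _ , y∉R , _)) eq =
            ⊥-elim (y∉R (subst (_∈ R) (trans (sym wⱼ≡r) eq) r∈R))
          injective (inj₂ (_ , _ , _ , y∉R , _)) (inj₁ (_ , wⱼ′≡r)) eq =
            ⊥-elim (y∉R (subst (_∈ R) (sym (trans eq wⱼ′≡r)) r∈R))
          injective {j} {j′} (inj₂ (_ , _ , y∈Rsⱼ , _)) (inj₂ (_ , _ , y∈Rsⱼ′ , _)) eq =
            Rs-injective (IsComponent-unique (Rs-component j) (Rs-component j′)
                                             y∈Rsⱼ (subst (_∈ Rs j′) (sym eq) y∈Rsⱼ′))

        cK≤∣Y∣+1 : cK ≤ ∣ Y ∣ + 1
        cK≤∣Y∣+1 =
          ℕP.≤-trans (injective⇒≤∣p∣ (Y ∪ ⁅ r ⁆) witness witness-injective λ j → ∈Y∪⁅r⁆ (witness-ok j))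
            (ℕP.≤-trans (∣p∪q∣≤∣p∣+∣q∣ Y ⁅ r ⁆) (ℕP.≤-reflexive (cong (λ x → ∣ Y ∣ + x) (∣⁅x⁆∣≡1 r))))
          where
          ∈Y∪⁅r⁆ : ∀ {j} → Witness j (witness j) → witness j ∈ Y ∪ ⁅ r ⁆
          ∈Y∪⁅r⁆ (inj₁ (_ , w≡r)) = x∈p∪q⁺ (inj₂ (subst (_∈ ⁅ r ⁆) (sym w≡r) (x∈⁅x⁆ r)))
          ∈Y∪⁅r⁆ (inj₂ (_ , y∈Y , _)) = x∈p∪q⁺ (inj₁ y∈Y)

        2≤∣K∣ : 2 ≤ ∣ K ∣
        2≤∣K∣ = injective⇒≤∣p∣ K pick pick-injective pick∈K
          where
          pick : Fin 2 → Fin n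
          pick zero = proj₁ (touching-vertex touch₁)
          pick (suc _) = proj₁ (touching-vertex touch₂)
          pick∈K : ∀ i → pick i ∈ K
          pick∈K zero = proj₁ (proj₂ (touching-vertex touch₁))
          pick∈K (suc zero) = proj₁ (proj₂ (touching-vertex touch₂))
          pick-injective : Injective _≡_ _≡_ pick
          pick-injective {zero} {zero} _ = refl
          pick-injective {suc zero} {suc zero} _ = refl
          pick-injective {zero} {suc zero} eq = ⊥-elim (i₁≢i₂ (trans (sym (proj₂ (proj₂ (touching-vertex touch₁))))
            (trans (cong CD.label eq) (proj₂ (proj₂ (touching-vertex touch₂))))))
          pick-injective {suc zero} {zero} eq = ⊥-elim (i₁≢i₂ (trans (sym (proj₂ (proj₂ (touching-vertex touch₁))))
            (trans (cong CD.label (sym eq)) (proj₂ (proj₂ (touching-vertex touch₂))))))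

        2≤cK : 2 ≤ cK
        2≤cK = ℕP.≮⇒≥ λ cK<2 → ℕP.<-irrefl refl (begin-strict
          Q * 1       <⟨ ℕP.*-monoʳ-< Q (s≤s (s≤s z≤n)) ⟩
          Q * 2       ≤⟨ ℕP.*-monoʳ-≤ Q 2≤∣K∣ ⟩
          Q * ∣ K ∣   ≤⟨ Q*∣K∣≤P*cK ⟩
          P * cK      ≤⟨ ℕP.*-monoʳ-≤ P (ℕP.≤-pred cK<2) ⟩
          P * 1       ≤⟨ ℕP.*-monoˡ-≤ 1 P≤Q ⟩
          Q * 1       ∎)
          where open ℕP.≤-Reasoning

        Z : Subset n
        Z = (T₀ ─ Y) ∪ K

        ∈∁Z⁺ : ∀ {z} → z ∉ K → (z ∈ T₀ → z ∈ Y) → z ∈ ∁ Z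
        ∈∁Z⁺ z∉K T₀⇒Y = x∉p⇒x∈∁p λ z∈Z →
          [ (λ z∈T₀─Y → proj₂ (x∈p─q⁻ z∈T₀─Y) (T₀⇒Y (proj₁ (x∈p─q⁻ z∈T₀─Y)))) , z∉K ]′ (x∈p∪q⁻ (T₀ ─ Y) K z∈Z)

        ∈∁Z⁻ : ∀ {z} → z ∈ ∁ Z → z ∉ K × (z ∈ T₀ → z ∈ Y)
        ∈∁Z⁻ {z} z∈∁Z = (λ z∈K → x∈∁p⇒x∉p z∈∁Z (x∈p∪q⁺ (inj₂ z∈K))) , λ z∈T₀ →
          decidable-stable (z ∈? Y) λ z∉Y → x∈∁p⇒x∉p z∈∁Z (x∈p∪q⁺ (inj₁ (x∈p∧x∉q⇒x∈p─q z∈T₀ z∉Y)))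

        r∈∁Z : r ∈ ∁ Z
        r∈∁Z = ∈∁Z⁺ (λ r∈K → proj₁ (∈D⁻ (K⊆D r∈K)) r∈R) (λ r∈T₀ → ⊥-elim (r∉T₀ r∈T₀))

        ∉R∧∉D∧∈∁Z⇒∈Y : ∀ {y} → y ∉ R → y ∉ D → y ∈ ∁ Z → y ∈ Y
        ∉R∧∉D∧∈∁Z⇒∈Y y∉R y∉D y∈∁Z = proj₂ (∈∁Z⁻ y∈∁Z) (∉R∧∉D⇒∈T₀ y∉R y∉D)

        InComponentD : Fin c′ → Fin n → Set
        InComponentD ℓ v = v ∈ D × CD.label v ≡ ℓ

        componentD : Fin c′ → Subset n
        componentD ℓ = toSubset λ v → (v ∈? D) ×-dec (CD.label v ≟ ℓ)

        ∈-componentD⁺ : ∀ {ℓ v} → InComponentD ℓ v → v ∈ componentD ℓ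
        ∈-componentD⁺ = ∈-toSubset⁺ _

        ∈-componentD⁻ : ∀ {ℓ v} → v ∈ componentD ℓ → InComponentD ℓ v
        ∈-componentD⁻ = ∈-toSubset⁻ _

        componentD-stepClosed : ∀ ℓ → ¬ Touching ℓ → StepClosed (∁ Z) (componentD ℓ)
        componentD-stepClosed ℓ ¬touch {x} {y} x∈ y∈∁Z xy =
          ∈-componentD⁺ (y∈D , trans (sym (label-edge x∈D y∈D xy)) lx)
          where
          x∈D : x ∈ D
          x∈D = proj₁ (∈-componentD⁻ x∈)
          lx : CD.label x ≡ ℓ
          lx = proj₂ (∈-componentD⁻ x∈)
          y∉R : y ∉ R
          y∉R y∈R = ¬touch (x , (x∈D , lx) , y , y∈R , xy)
          x∉K : x ∉ K
          x∉K x∈K = ¬touch (subst Touching lx (proj₂ (∈K⁻ x∈K)))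
          y∈D : y ∈ D
          y∈D = decidable-stable (y ∈? D) λ y∉D → D─K≁Y x∈D x∉K (∉R∧∉D∧∈∁Z⇒∈Y y∉R y∉D y∈∁Z) xy

        R-stepClosed-∁Z : StepClosed (∁ Z) R
        R-stepClosed-∁Z {x} {y} x∈R y∈∁Z xy = decidable-stable (y ∈? R) λ y∉R →
          [ (λ y∈D → proj₁ (∈∁Z⁻ y∈∁Z) (∈K⁺ y∈D (y , (y∈D , refl) , x , x∈R , Graph.sym G xy))) ,
            (λ y∉D → proj₁ (proj₂ (∈Y⁻ (∉R∧∉D∧∈∁Z⇒∈Y y∉R y∉D y∈∁Z)))
                       (∉R-adjacent-R⇒∈S y∉R x∈R (Graph.sym G xy))) ]′ (toSum (y ∈? D))

        Y∩Rs-stepClosed : ∀ j → StepClosed (∁ Z) (Y ∩ Rs j)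
        Y∩Rs-stepClosed j {x} {y} x∈ y∈∁Z xy =
          x∈p∩q⁺ (y∈Y , proj₂ (proj₂ (proj₂ (Rs-component j))) x y x∈Rsⱼ
                           (Reach-edge (x∉p⇒x∈∁p x∉S) (x∉p⇒x∈∁p (proj₁ (proj₂ (∈Y⁻ y∈Y)))) xy))
          where
          x∈Y : x ∈ Y
          x∈Y = proj₁ (x∈p∩q⁻ Y (Rs j) x∈)
          x∈Rsⱼ : x ∈ Rs j
          x∈Rsⱼ = proj₂ (x∈p∩q⁻ Y (Rs j) x∈)
          x∉S : x ∉ S
          x∉S = proj₁ (proj₂ (∈Y⁻ x∈Y))
          y∉R : y ∉ R
          y∉R y∈R = x∉S (∉R-adjacent-R⇒∈S (proj₂ (∈T₀⁻ (Y⊆T₀ x∈Y))) y∈R xy)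
          y∉D : y ∉ D
          y∉D y∈D = D─K≁Y y∈D (proj₁ (∈∁Z⁻ y∈∁Z)) x∈Y (Graph.sym G xy)
          y∈Y : y ∈ Y
          y∈Y = ∉R∧∉D∧∈∁Z⇒∈Y y∉R y∉D y∈∁Z

        touching : Subset c′
        touching = toSubset Touching?

        untouched : ∀ i → ¬ Touching (members (∁ touching) i)
        untouched i touch = x∈∁p⇒x∉p (members-∈ (∁ touching) i) (∈-toSubset⁺ Touching? touch)

        untouched-rep : Fin ∣ ∁ touching ∣ → Fin n
        untouched-rep i = CD.rep (members (∁ touching) i)

        untouched-rep∈∁Z : ∀ i → untouched-rep i ∈ ∁ Z
        untouched-rep∈∁Z i = ∈∁Z⁺ (λ x∈K → untouched i (subst Touching (CD.label-rep _) (proj₂ (∈K⁻ x∈K))))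
                                  (λ x∈T₀ → ⊥-elim (proj₂ (∈D⁻ (CD.rep∈ _)) (proj₁ (∈T₀⁻ x∈T₀))))

        from-untouched-stays : ∀ i {v} → Reach A (∁ Z) (untouched-rep i) v →
                               v ∈ componentD (members (∁ touching) i)
        from-untouched-stays i r′ = Reach-closed _ (componentD-stepClosed _ (untouched i)) r′
          (∈-componentD⁺ (CD.rep∈ _ , CD.label-rep _))

        witness∉D : ∀ {j} → Witness j (witness j) → witness j ∉ D
        witness∉D (inj₁ (_ , w≡r)) w∈D = proj₁ (∈D⁻ w∈D) (subst (_∈ R) (sym w≡r) r∈R)
        witness∉D (inj₂ (_ , _ , _ , _ , y∉D)) = y∉D

        witness∈∁Z : ∀ {j} → Witness j (witness j) → witness j ∈ ∁ Z
        witness∈∁Z (inj₁ (_ , w≡r)) = subst (_∈ ∁ Z) (sym w≡r) r∈∁Z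
        witness∈∁Z (inj₂ (_ , y∈Y , _ , _ , y∉D)) = ∈∁Z⁺ (λ y∈K → y∉D (K⊆D y∈K)) (λ _ → y∈Y)

        witnesses-separated : ∀ {j j′} → Witness j (witness j) → Witness j′ (witness j′) →
                              Reach A (∁ Z) (witness j) (witness j′) → j ≡ j′
        witnesses-separated (inj₁ (Rsⱼ≡R , _)) (inj₁ (Rsⱼ′≡R , _)) _ = Rs-injective (trans Rsⱼ≡R (sym Rsⱼ′≡R))
        witnesses-separated (inj₁ (_ , w≡r)) (inj₂ (_ , _ , _ , y∉R , _)) r′ =
          ⊥-elim (y∉R (Reach-closed R R-stepClosed-∁Z r′ (subst (_∈ R) (sym w≡r) r∈R)))
        witnesses-separated {j} (inj₂ (_ , y∈Y , y∈Rsⱼ , _)) (inj₁ (_ , w≡r)) r′ =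
          ⊥-elim (r∉T₀ (Y⊆T₀ (subst (_∈ Y) w≡r
            (proj₁ (x∈p∩q⁻ Y (Rs j) (Reach-closed _ (Y∩Rs-stepClosed j) r′ (x∈p∩q⁺ (y∈Y , y∈Rsⱼ))))))))
        witnesses-separated {j} {j′} (inj₂ (_ , y∈Y , y∈Rsⱼ , _)) (inj₂ (_ , _ , y′∈Rsⱼ′ , _)) r′ =
          Rs-injective (IsComponent-unique (Rs-component j) (Rs-component j′)
            (proj₂ (x∈p∩q⁻ Y (Rs j) (Reach-closed _ (Y∩Rs-stepClosed j) r′ (x∈p∩q⁺ (y∈Y , y∈Rsⱼ))))) y′∈Rsⱼ′)

        untouched+cK≤c[G-Z] : ∀ {cZ} → NumComponents A (∁ Z) cZ → ∣ ∁ touching ∣ + cK ≤ cZ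
        untouched+cK≤c[G-Z] ncZ = separated₂⇒+≤ ncZ untouched-rep witness
          (λ i j r′ → members-injective (∁ touching)
            (trans (sym (proj₂ (∈-componentD⁻ (from-untouched-stays i r′)))) (CD.label-rep _)))
          (λ j j′ → witnesses-separated (witness-ok j) (witness-ok j′))
          (λ i j r′ → witness∉D (witness-ok j) (proj₁ (∈-componentD⁻ (from-untouched-stays i r′))))
          untouched-rep∈∁Z (λ j → witness∈∁Z (witness-ok j))

        ∣touching∣≤∣K∣ : ∣ touching ∣ ≤ ∣ K ∣
        ∣touching∣≤∣K∣ = injective⇒≤∣p∣ K (λ i → CD.rep (members touching i))
          (λ eq → members-injective touching
                    (trans (sym (CD.label-rep _)) (trans (cong CD.label eq) (CD.label-rep _))))
          (λ i → ∈K⁺ (CD.rep∈ _)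
                   (subst Touching (sym (CD.label-rep _)) (∈-toSubset⁻ Touching? (members-∈ touching i))))

        bound-by : ∀ {cZ} → NumComponents A (∁ Z) cZ → P * c′ ≤ Q * ∣ T ∣
        bound-by {cZ} ncZ = begin
          P * c′                                 ≡⟨ cong (P *_) (sym (∣p∣+∣∁p∣≡n touching)) ⟩
          P * (∣ touching ∣ + ∣ ∁ touching ∣)    ≡⟨ ℕP.*-distribˡ-+ P ∣ touching ∣ ∣ ∁ touching ∣ ⟩
          P * ∣ touching ∣ + P * ∣ ∁ touching ∣  ≤⟨ ℕP.+-mono-≤ touching-bound untouched-bound ⟩
          Q * (∣ Y ∣ + 1) + Q * ∣ T₀ ─ Y ∣       ≡⟨ regroup Q ∣ Y ∣ ∣ T₀ ─ Y ∣ ⟩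
          Q * (∣ T₀ ─ Y ∣ + ∣ Y ∣ + 1)           ≡⟨ cong (λ x → Q * (x + 1)) (∣p─q∣+∣q∣≡∣p∣ T₀ Y Y⊆T₀) ⟩
          Q * (∣ T₀ ∣ + 1)                       ≡⟨ cong (Q *_) ∣T₀∣+1≡∣T∣ ⟩
          Q * ∣ T ∣                              ∎
          where
          open ℕP.≤-Reasoning
          regroup : ∀ Q y z → Q * (y + 1) + Q * z ≡ Q * (z + y + 1)
          regroup = solve-∀
          touching-bound : P * ∣ touching ∣ ≤ Q * (∣ Y ∣ + 1)
          touching-bound = begin
            P * ∣ touching ∣   ≤⟨ ℕP.*-monoʳ-≤ P ∣touching∣≤∣K∣ ⟩
            P * ∣ K ∣          ≤⟨ ℕP.*-monoˡ-≤ ∣ K ∣ P≤Q ⟩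
            Q * ∣ K ∣          ≤⟨ Q*∣K∣≤P*cK ⟩
            P * cK             ≤⟨ ℕP.*-monoˡ-≤ cK P≤Q ⟩
            Q * cK             ≤⟨ ℕP.*-monoʳ-≤ Q cK≤∣Y∣+1 ⟩
            Q * (∣ Y ∣ + 1)    ∎
          untouched-bound : P * ∣ ∁ touching ∣ ≤ Q * ∣ T₀ ─ Y ∣
          untouched-bound = ℕP.+-cancelʳ-≤ (P * cK) _ _ (begin
            P * ∣ ∁ touching ∣ + P * cK    ≡⟨ sym (ℕP.*-distribˡ-+ P ∣ ∁ touching ∣ cK) ⟩
            P * (∣ ∁ touching ∣ + cK)      ≤⟨ ℕP.*-monoʳ-≤ P (untouched+cK≤c[G-Z] ncZ) ⟩
            P * cZ                         ≤⟨ toughness-bound Z cZ ncZ (ℕP.≤-trans 2≤cK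
                                                (ℕP.≤-trans (ℕP.m≤n+m cK _) (untouched+cK≤c[G-Z] ncZ))) ⟩
            Q * ∣ Z ∣                      ≤⟨ ℕP.*-monoʳ-≤ Q (∣p∪q∣≤∣p∣+∣q∣ (T₀ ─ Y) K) ⟩
            Q * (∣ T₀ ─ Y ∣ + ∣ K ∣)       ≡⟨ ℕP.*-distribˡ-+ Q ∣ T₀ ─ Y ∣ ∣ K ∣ ⟩
            Q * ∣ T₀ ─ Y ∣ + Q * ∣ K ∣     ≤⟨ ℕP.+-monoʳ-≤ (Q * ∣ T₀ ─ Y ∣) Q*∣K∣≤P*cK ⟩
            Q * ∣ T₀ ─ Y ∣ + P * cK        ∎)

        bound : P * c′ ≤ Q * ∣ T ∣
        bound = bound-by (proj₂ (numComponents (∁ Z) (r , r∈∁Z)))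

      bound : P * c′ ≤ Q * ∣ T ∣
      bound = [ (λ (i₁ , i₂ , i₁≢i₂ , touch₁ , touch₂) → TwoTouchingComponents.bound i₁ i₂ i₁≢i₂ touch₁ touch₂) ,
                AtMostOneTouching.bound ]′ (toSum twoTouching?)

    tough : ToughOn B W′ t
    tough = proj₁ (proj₁ τ≡t) , λ T c′ T⊆W′ nc′ 2≤c′ → P*m≤Q*n⇒t*m≤n c′ ∣ T ∣ (bound T c′ T⊆W′ nc′ 2≤c′ (r ∈? T))
      where
      bound : ∀ T c′ → T ⊆ W′ → NumComponents B (W′ ─ T) c′ → 2 ≤ c′ → Dec (r ∈ T) → P * c′ ≤ Q * ∣ T ∣
      bound T c′ T⊆W′ nc′ 2≤c′ (yes r∈T) = WithR.bound T c′ T⊆W′ nc′ 2≤c′ r∈T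
      bound T c′ T⊆W′ nc′ 2≤c′ (no r∉T) = WithoutR.bound T c′ T⊆W′ nc′ r∉T 2≤c′

  P₄-free⇒contraction-tough : ¬ HasInducedP4 G → ∀ R → IsComponent A (∁ S) R → ∀ r → r ∈ R →
                              ToughOn (ContractAdj G R r) (∁ R ∪ ⁅ r ⁆) t
  P₄-free⇒contraction-tough P₄-free R R-component r r∈R = Contraction.tough P₄-free R R-component r r∈R

-- imported only here: with the prefix +_ in scope, sums involving ∣ p ∣ become ambiguous to parse
open import Data.Integer using (+_)

lemma2p5 : ∀ {n} (G : Graph n) (t : ℚ) (S : Subset n) →
  Connected G → Toughness≡ G t → t ℚ.≤ 1ℚ → ToughSet G S →
  -- (i)  |S'| / t + 1 ≤ m, written as |S'| + t ≤ t · m  (t > 0)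
  (∀ S′ → Nonempty S′ → S′ ⊂ S →
    ∃[ m ] (AdjToAtLeast G S S′ m × ℕ→ℚ ∣ S′ ∣ ℚ.+ t ℚ.≤ t ℚ.* ℕ→ℚ m)) ×
  -- (ii) |S'| / t ≤ m, written as |S'| ≤ t · m
  (∀ S′ → Nonempty S′ → S′ ⊆ S →
    ∃[ m ] (AdjToAtLeast G S S′ m × ℕ→ℚ ∣ S′ ∣ ℚ.≤ t ℚ.* ℕ→ℚ m)) ×
  -- (iii)
  (∀ v → v ∈ S → AdjToAtLeast G S ⁅ v ⁆ 2) ×
  -- (iv)
  (MaximalToughSet G S → (k : ℕ) .{{_ : NonZero k}} → (+ 1 / k) ℚ.≤ t →
    ∀ R → IsComponent (Adj G) (∁ S) R → ToughOn (Adj G) R (+ 1 / k)) ×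
  -- (v)
  (¬ HasInducedP4 G → ∀ R → IsComponent (Adj G) (∁ S) R → ∀ r → r ∈ R →
    ToughOn (ContractAdj G R r) (∁ R ∪ ⁅ r ⁆) t)
lemma2p5 G t S _ τ≡t t≤1 (t′ , τ≡t′ , _ , ncS , s≤s (s≤s {n = c₁} z≤n) , ∣S∣≡t′*c) =
  adjacent-components-⊂ , adjacent-components-⊆ , adjacent-components-vertex ,
  maximal⇒component-tough , P₄-free⇒contraction-tough
  where
  open ToughSetProperties G t τ≡t t≤1 S c₁ ncS
    (subst (λ t″ → ℕ→ℚ ∣ S ∣ ≡ t″ ℚ.* ℕ→ℚ (2 + c₁)) (Toughness≡-unique G τ≡t τ≡t′) ∣S∣≡t′*c)
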